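{- For every integer $m\ge1$, \[ \frac{1}{(q;q)_{\infty}} \sum_{l=0}^{m-1}(-1)^{l} q^{\frac{l(3l+1)}{2}}(1-q^{2l+1})= 1+(-1)^{m-1}\sum_{d=1}^{\infty} \frac{q^{d^2+d+\binom{m}{2}}}{(q;q)_{2d}} \frac{1-q^m}{1-q^d}\begin{bmatrix} 2d\\ d+m\end{bmatrix}_q \] and \[ \frac{1}{(q;q)_{\infty}} \sum_{l=0}^{m-1}(-1)^{l} q^{\frac{l(3l-1)}{2}}(1-q^{4l+2})= 1+(-1)^{m-1}\sum_{d=1}^{\infty} \frac{q^{d^2+\binom{m}{2}}}{(q;q)_{2d}} \frac{1-q^m}{1-q^d}\begin{bmatrix} 2d\\ d+m\end{bmatrix}_q. \]
   Context: Notation: $(a;q)_n=(1-a)(1-aq)\cdots(1-aq^{n-1})$, $(a;q)_\infty=\prod_{k\ge 0}(1-aq^k)$ for $|q|<1$, and $\begin{bmatrix} n\\ k\end{bmatrix}_q=\frac{(q;q)_n}{(q;q)_k(q;q)_{n-k}}$ for $n\ge k\ge 0$, and $0$ otherwise (in particular it vanishes when $k>n$). -}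

module Defs where

open import Data.Nat as ℕ using (ℕ; zero; suc; _∸_; _≟_)
open import Data.Integer as ℤ using (ℤ; +_; -_; _^_)
open import Data.List using (List; []; _∷_; zipWith; foldr; applyUpTo)
open import Data.Product using (Σ)
open import Relation.Binary.PropositionalEquality using (_≡_)
open import Relation.Nullary using (yes; no)

sum : List ℤ → ℤ
sum = foldr ℤ._+_ (+ 0)

-- Formal power series in q with integer coefficients: n ↦ coefficient of q^n.
PS : Set
PS = ℕ → ℤ

constPS : ℤ → PS
constPS c zero    = c
constPS c (suc _) = + 0

1PS : PS
1PS = constPS (+ 1)

qpow : ℕ → PS
qpow k n with n ≟ k
... | yes _ = + 1
... | no  _ = + 0

_⊕_ : PS → PS → PS
(f ⊕ g) n = f n ℤ.+ g n

⊝_ : PS → PS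
(⊝ f) n = ℤ.- f n

_⊖_ : PS → PS → PS
f ⊖ g = f ⊕ (⊝ g)

_·_ : ℤ → PS → PS
(c · f) n = c ℤ.* f n

_⊛_ : PS → PS → PS
(f ⊛ g) n = sum (applyUpTo (λ i → f i ℤ.* g (n ∸ i)) (suc n))

infixl 6 _⊕_ _⊖_
infixl 7 _⊛_ _·_
infix  8 ⊝_

-- Multiplicative inverse of a power series with constant term 1
-- (the only case used below): g 0 = 1,  g n = - Σ_{i=1}^{n} f i * g (n - i).
-- invList f n = [g n , g (n-1) , … , g 0]
invList : PS → ℕ → List ℤ
invList f zero    = + 1 ∷ []
invList f (suc n) =
  (ℤ.- sum (zipWith ℤ._*_ (applyUpTo (λ i → f (suc i)) (suc n)) prev)) ∷ prev
  where prev = invList f n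

inv : PS → PS
inv f n with invList f n
... | x ∷ _ = x
... | []    = + 0

sumPS : ℕ → (ℕ → PS) → PS
sumPS zero    F = λ _ → + 0
sumPS (suc k) F = sumPS k F ⊕ F k

qqPoch : ℕ → PS
qqPoch zero    = 1PS
qqPoch (suc n) = qqPoch n ⊛ (1PS ⊖ qpow (suc n))

qbinom : ℕ → ℕ → PS
qbinom n k with k ℕ.≤? n
... | yes _ = qqPoch n ⊛ inv (qqPoch k) ⊛ inv (qqPoch (n ∸ k))
... | no  _ = λ _ → + 0

sgn : ℕ → ℤ
sgn l = (ℤ.- + 1) ^ l

choose2 : ℕ → ℕ
choose2 m = (m ℕ.* (m ∸ 1)) ℕ./ 2

lhsPoly₁ : ℕ → PS
lhsPoly₁ m = sumPS m (λ l →
  sgn l · (qpow ((l ℕ.* (3 ℕ.* l ℕ.+ 1)) ℕ./ 2) ⊛ (1PS ⊖ qpow (2 ℕ.* l ℕ.+ 1))))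

lhsPoly₂ : ℕ → PS
lhsPoly₂ m = sumPS m (λ l →
  sgn l · (qpow ((l ℕ.* (3 ℕ.* l ∸ 1)) ℕ./ 2) ⊛ (1PS ⊖ qpow (4 ℕ.* l ℕ.+ 2))))

term₁ : ℕ → ℕ → PS
term₁ m d = qpow (d ℕ.* d ℕ.+ d ℕ.+ choose2 m) ⊛ inv (qqPoch (2 ℕ.* d))
            ⊛ (1PS ⊖ qpow m) ⊛ inv (1PS ⊖ qpow d) ⊛ qbinom (2 ℕ.* d) (d ℕ.+ m)

term₂ : ℕ → ℕ → PS
term₂ m d = qpow (d ℕ.* d ℕ.+ choose2 m) ⊛ inv (qqPoch (2 ℕ.* d))
            ⊛ (1PS ⊖ qpow m) ⊛ inv (1PS ⊖ qpow d) ⊛ qbinom (2 ℕ.* d) (d ℕ.+ m)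

partialSum : (ℕ → PS) → ℕ → PS
partialSum T N = sumPS N (λ j → T (suc j))

-- Two sequences of power series have the same (q-adic / coefficientwise) limit:
-- every coefficient of the two sequences eventually agrees.
SameLimit : (ℕ → PS) → (ℕ → PS) → Set
SameLimit A B = ∀ n → Σ ℕ (λ N → ∀ N' → N ℕ.≤ N' → A N' n ≡ B N' n)

module Submission where

-- All identities are proved modulo q^{n+1}, where power series form a
-- commutative ring (so the ring solver applies) and 1/(q;q)_N stabilises.
-- The main input is the Durfee rectangle identity
--   Σ_j q^{j²+kj} / ((q;q)_j (q;q)_{j+k}) = 1/(q;q)_∞   (every k ≥ 0),
-- obtained from two three-term recurrences that shift k without changing the
-- sum; for k large the sum is visibly 1/(q;q)_∞.  The corollary then follows by
-- induction on m: the summands for m = M and m = M+1 at the same d combine into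
-- q^{M(3M±1)/2} (1 - q^{2M+1}) times a Durfee term, so the two right-hand
-- sums add up to exactly the l = M term on the left divided by (q;q)_∞, and the
-- alternating signs telescope.  The case m = 1 is again a Durfee identity.

open import Defs
open import Level using (0ℓ)
open import Data.Nat as ℕ using (ℕ; zero; suc; _∸_; _≤_; _<_; z≤n; s≤s)
import Data.Nat.Properties as ℕP
open import Data.Nat.DivMod using (+-distrib-/-∣ʳ; m*n/n≡m)
open import Data.Nat.Divisibility using (divides)
import Data.Nat.Solver as ℕSolver
open import Data.Integer as ℤ using (ℤ; +_)
import Data.Integer.Properties as ℤP
import Data.Integer.Solver as ℤSolver
open import Data.List using (_∷_; applyUpTo; zipWith)
open import Data.Maybe using (Maybe; just; nothing)
open import Data.Product using (_×_; _,_; proj₁; proj₂)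
open import Data.Sum using (_⊎_; inj₁; inj₂)
open import Data.Empty using (⊥-elim)
open import Relation.Binary.PropositionalEquality as ≡ using (_≡_; _≢_; refl; cong; cong₂)
open import Relation.Nullary using (Dec; yes; no; ¬_)
open import Function using (_∘_)
open import Algebra.Bundles using (CommutativeRing)
open import Algebra.Solver.Ring.AlmostCommutativeRing using (fromCommutativeRing; _-Raw-AlmostCommutative⟶_)
import Algebra.Solver.Ring

∑ : ℕ → (ℕ → ℤ) → ℤ
∑ n F = sum (applyUpTo F n)

∑-cong : ∀ n {F G : ℕ → ℤ} → (∀ i → i < n → F i ≡ G i) → ∑ n F ≡ ∑ n G
∑-cong zero    eq = refl
∑-cong (suc n) eq = cong₂ ℤ._+_ (eq 0 (s≤s z≤n)) (∑-cong n (λ i i<n → eq (suc i) (s≤s i<n)))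

∑-zero : ∀ n {F : ℕ → ℤ} → (∀ i → i < n → F i ≡ + 0) → ∑ n F ≡ + 0
∑-zero zero    eq = refl
∑-zero (suc n) eq = cong₂ ℤ._+_ (eq 0 (s≤s z≤n)) (∑-zero n (λ i i<n → eq (suc i) (s≤s i<n)))

∑-+ : ∀ n (F G : ℕ → ℤ) → ∑ n (λ i → F i ℤ.+ G i) ≡ ∑ n F ℤ.+ ∑ n G
∑-+ zero    F G = refl
∑-+ (suc n) F G = ≡.trans (cong (ℤ._+_ (F 0 ℤ.+ G 0)) (∑-+ n (F ∘ suc) (G ∘ suc)))
  (interchange (F 0) (G 0) (∑ n (F ∘ suc)) (∑ n (G ∘ suc)))
  where
  open ℤSolver.+-*-Solver
  interchange : ∀ a b c d → (a ℤ.+ b) ℤ.+ (c ℤ.+ d) ≡ (a ℤ.+ c) ℤ.+ (b ℤ.+ d)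
  interchange = solve 4 (λ a b c d → (a :+ b) :+ (c :+ d) := (a :+ c) :+ (b :+ d)) refl

∑-*ˡ : ∀ n c (F : ℕ → ℤ) → ∑ n (λ i → c ℤ.* F i) ≡ c ℤ.* ∑ n F
∑-*ˡ zero    c F = ≡.sym (ℤP.*-zeroʳ c)
∑-*ˡ (suc n) c F = ≡.trans (cong (ℤ._+_ (c ℤ.* F 0)) (∑-*ˡ n c (F ∘ suc)))
  (≡.sym (ℤP.*-distribˡ-+ c (F 0) _))

∑-*ʳ : ∀ n c (F : ℕ → ℤ) → ∑ n (λ i → F i ℤ.* c) ≡ ∑ n F ℤ.* c
∑-*ʳ n c F = ≡.trans (∑-cong n (λ i _ → ℤP.*-comm (F i) c))
  (≡.trans (∑-*ˡ n c F) (ℤP.*-comm c _))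

∑-last : ∀ n (F : ℕ → ℤ) → ∑ (suc n) F ≡ ∑ n F ℤ.+ F n
∑-last zero    F = ≡.trans (ℤP.+-identityʳ (F 0)) (≡.sym (ℤP.+-identityˡ (F 0)))
∑-last (suc n) F = ≡.trans (cong (ℤ._+_ (F 0)) (∑-last n (F ∘ suc))) (≡.sym (ℤP.+-assoc (F 0) _ _))

suc-∸ : ∀ n a → a ≤ n → suc n ∸ a ≡ suc (n ∸ a)
suc-∸ n       zero    _         = refl
suc-∸ (suc n) (suc a) (s≤s a≤n) = suc-∸ n a a≤n

∑-reverse : ∀ n (F : ℕ → ℤ) → ∑ n F ≡ ∑ n (λ i → F (n ∸ suc i))
∑-reverse zero    F = refl
∑-reverse (suc n) F = begin
    F 0 ℤ.+ ∑ n (F ∘ suc)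
  ≡⟨ cong (ℤ._+_ (F 0)) (∑-reverse n (F ∘ suc)) ⟩
    F 0 ℤ.+ ∑ n (λ i → F (suc (n ∸ suc i)))
  ≡⟨ ℤP.+-comm (F 0) _ ⟩
    ∑ n (λ i → F (suc (n ∸ suc i))) ℤ.+ F 0
  ≡⟨ cong₂ ℤ._+_ (∑-cong n (λ i i<n → cong F (≡.sym (suc-∸ n (suc i) i<n))))
                 (cong F (≡.sym (ℕP.n∸n≡0 n))) ⟩
    ∑ n (λ i → F (n ∸ i)) ℤ.+ F (n ∸ n)
  ≡⟨ ≡.sym (∑-last n (λ i → F (n ∸ i))) ⟩
    ∑ (suc n) (λ i → F (n ∸ i))
  ∎ where open ≡.≡-Reasoning

∑-triangle : ∀ n (X : ℕ → ℕ → ℤ) →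
  ∑ (suc n) (λ i → ∑ (suc i) (λ a → X a i)) ≡ ∑ (suc n) (λ a → ∑ (suc (n ∸ a)) (λ b → X a (a ℕ.+ b)))
∑-triangle zero    X = refl
∑-triangle (suc n) X = begin
    ∑ (suc (suc n)) (λ i → ∑ (suc i) (λ a → X a i))
  ≡⟨ ∑-last (suc n) (λ i → ∑ (suc i) (λ a → X a i)) ⟩
    ∑ (suc n) (λ i → ∑ (suc i) (λ a → X a i)) ℤ.+ ∑ (suc (suc n)) (λ a → X a (suc n))
  ≡⟨ cong₂ ℤ._+_ (∑-triangle n X) (∑-last (suc n) (λ a → X a (suc n))) ⟩
    Rows n ℤ.+ (∑ (suc n) (λ a → X a (suc n)) ℤ.+ X (suc n) (suc n))
  ≡⟨ ≡.sym (ℤP.+-assoc (Rows n) _ _) ⟩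
    (Rows n ℤ.+ ∑ (suc n) (λ a → X a (suc n))) ℤ.+ X (suc n) (suc n)
  ≡⟨ cong₂ ℤ._+_ (≡.sym (∑-+ (suc n) (λ a → Row a n) (λ a → X a (suc n)))) lastRow ⟩
    ∑ (suc n) (λ a → Row a n ℤ.+ X a (suc n)) ℤ.+ Row (suc n) (suc n)
  ≡⟨ cong (ℤ._+ Row (suc n) (suc n)) (∑-cong (suc n) extendRow) ⟩
    ∑ (suc n) (λ a → Row a (suc n)) ℤ.+ Row (suc n) (suc n)
  ≡⟨ ≡.sym (∑-last (suc n) (λ a → Row a (suc n))) ⟩
    ∑ (suc (suc n)) (λ a → Row a (suc n))
  ∎ where
  open ≡.≡-Reasoning
  Row : ℕ → ℕ → ℤ
  Row a n = ∑ (suc (n ∸ a)) (λ b → X a (a ℕ.+ b))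
  Rows : ℕ → ℤ
  Rows n = ∑ (suc n) (λ a → Row a n)
  lastRow : X (suc n) (suc n) ≡ Row (suc n) (suc n)
  lastRow = ≡.sym (≡.trans (cong (λ k → ∑ (suc k) (λ b → X (suc n) (suc n ℕ.+ b))) (ℕP.n∸n≡0 n))
                          (≡.trans (ℤP.+-identityʳ _) (cong (X (suc n)) (ℕP.+-identityʳ (suc n)))))
  extendRow : ∀ a → a < suc n → Row a n ℤ.+ X a (suc n) ≡ Row a (suc n)
  extendRow a (s≤s a≤n) = begin
      Row a n ℤ.+ X a (suc n)
    ≡⟨ cong (λ k → Row a n ℤ.+ X a k)
            (≡.sym (≡.trans (ℕP.+-suc a (n ∸ a)) (cong suc (ℕP.m+[n∸m]≡n a≤n)))) ⟩
      Row a n ℤ.+ X a (a ℕ.+ suc (n ∸ a))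
    ≡⟨ ≡.sym (∑-last (suc (n ∸ a)) (λ b → X a (a ℕ.+ b))) ⟩
      ∑ (suc (suc (n ∸ a))) (λ b → X a (a ℕ.+ b))
    ≡⟨ cong (λ k → ∑ (suc k) (λ b → X a (a ℕ.+ b))) (≡.sym (suc-∸ n a a≤n)) ⟩
      Row a (suc n)
    ∎

-- Since coefficient n of
-- a sum or Cauchy product only depends on coefficients of degree ≤ n, this is a
-- congruence, and power series modulo q^(n+1) form a commutative ring.
infix 4 _≈[_]_
record _≈[_]_ (f : PS) (n : ℕ) (g : PS) : Set where
  constructor mk≈
  field coeff : ∀ i → i ≤ n → f i ≡ g i
open _≈[_]_ public

pointwise : ∀ {f g : PS} {n} → (∀ i → f i ≡ g i) → f ≈[ n ] g
pointwise eq = mk≈ (λ i _ → eq i)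

≈-refl : ∀ {n} f → f ≈[ n ] f
≈-refl f = mk≈ (λ _ _ → refl)

≡⇒≈ : ∀ {n} {f g : PS} → f ≡ g → f ≈[ n ] g
≡⇒≈ refl = mk≈ (λ _ _ → refl)

⊛-comm : ∀ f g i → (f ⊛ g) i ≡ (g ⊛ f) i
⊛-comm f g n = ≡.trans (∑-reverse (suc n) (λ i → f i ℤ.* g (n ∸ i)))
  (∑-cong (suc n) {λ i → f (n ∸ i) ℤ.* g (n ∸ (n ∸ i))} {λ i → g i ℤ.* f (n ∸ i)}
    (λ i i≤n → ≡.trans (ℤP.*-comm (f (n ∸ i)) _)
                       (cong (λ k → g k ℤ.* f (n ∸ i)) (ℕP.m∸[m∸n]≡n (ℕP.≤-pred i≤n)))))

⊛-assoc : ∀ f g h i → ((f ⊛ g) ⊛ h) i ≡ (f ⊛ (g ⊛ h)) i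
⊛-assoc f g h n = begin
    ∑ (suc n) (λ i → ∑ (suc i) (λ a → f a ℤ.* g (i ∸ a)) ℤ.* h (n ∸ i))
  ≡⟨ ∑-cong (suc n) (λ i _ → ≡.sym (∑-*ʳ (suc i) (h (n ∸ i)) (λ a → f a ℤ.* g (i ∸ a)))) ⟩
    ∑ (suc n) (λ i → ∑ (suc i) (λ a → f a ℤ.* g (i ∸ a) ℤ.* h (n ∸ i)))
  ≡⟨ ∑-triangle n (λ a i → f a ℤ.* g (i ∸ a) ℤ.* h (n ∸ i)) ⟩
    ∑ (suc n) (λ a → ∑ (suc (n ∸ a)) (λ b → f a ℤ.* g ((a ℕ.+ b) ∸ a) ℤ.* h (n ∸ (a ℕ.+ b))))
  ≡⟨ ∑-cong (suc n) (λ a _ → ∑-cong (suc (n ∸ a)) (λ b _ →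
       ≡.trans (cong₂ (λ x y → f a ℤ.* g x ℤ.* h y) (ℕP.m+n∸m≡n a b) (≡.sym (ℕP.∸-+-assoc n a b)))
               (ℤP.*-assoc (f a) (g b) (h ((n ∸ a) ∸ b))))) ⟩
    ∑ (suc n) (λ a → ∑ (suc (n ∸ a)) (λ b → f a ℤ.* (g b ℤ.* h ((n ∸ a) ∸ b))))
  ≡⟨ ∑-cong (suc n) (λ a _ → ∑-*ˡ (suc (n ∸ a)) (f a) (λ b → g b ℤ.* h ((n ∸ a) ∸ b))) ⟩
    ∑ (suc n) (λ a → f a ℤ.* ∑ (suc (n ∸ a)) (λ b → g b ℤ.* h ((n ∸ a) ∸ b)))
  ∎ where open ≡.≡-Reasoning

⊛-distribˡ : ∀ f g h i → (f ⊛ (g ⊕ h)) i ≡ (f ⊛ g ⊕ f ⊛ h) i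
⊛-distribˡ f g h n =
  ≡.trans (∑-cong (suc n) (λ i _ → ℤP.*-distribˡ-+ (f i) (g (n ∸ i)) (h (n ∸ i))))
          (∑-+ (suc n) (λ i → f i ℤ.* g (n ∸ i)) (λ i → f i ℤ.* h (n ∸ i)))

⊛-distribʳ : ∀ f g h i → ((g ⊕ h) ⊛ f) i ≡ (g ⊛ f ⊕ h ⊛ f) i
⊛-distribʳ f g h n =
  ≡.trans (∑-cong (suc n) (λ i _ → ℤP.*-distribʳ-+ (f (n ∸ i)) (g i) (h i)))
          (∑-+ (suc n) (λ i → g i ℤ.* f (n ∸ i)) (λ i → h i ℤ.* f (n ∸ i)))

⊛-identityˡ : ∀ f i → (1PS ⊛ f) i ≡ f i
⊛-identityˡ f n = ≡.trans (cong₂ ℤ._+_ (ℤP.*-identityˡ (f n)) (∑-zero n (λ _ _ → refl)))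
                          (ℤP.+-identityʳ (f n))

⊛-identityʳ : ∀ f i → (f ⊛ 1PS) i ≡ f i
⊛-identityʳ f i = ≡.trans (⊛-comm f 1PS i) (⊛-identityˡ f i)

⊛-cong : ∀ {n f f′ g g′} → f ≈[ n ] f′ → g ≈[ n ] g′ → f ⊛ g ≈[ n ] f′ ⊛ g′
⊛-cong {n} f≈ g≈ = mk≈ λ i i≤n → ∑-cong (suc i) (λ a a≤i →
  cong₂ ℤ._*_ (coeff f≈ a (ℕP.≤-trans (ℕP.≤-pred a≤i) i≤n))
              (coeff g≈ (i ∸ a) (ℕP.≤-trans (ℕP.m∸n≤m i a) i≤n)))

+-identity-at : ∀ f i → (constPS (+ 0) ⊕ f) i ≡ f i × (f ⊕ constPS (+ 0)) i ≡ f i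
+-identity-at f zero    = ℤP.+-identityˡ (f 0) , ℤP.+-identityʳ (f 0)
+-identity-at f (suc i) = ℤP.+-identityˡ (f (suc i)) , ℤP.+-identityʳ (f (suc i))

+-inverse-at : ∀ f i → (⊝ f ⊕ f) i ≡ constPS (+ 0) i × (f ⊕ ⊝ f) i ≡ constPS (+ 0) i
+-inverse-at f zero    = ℤP.+-inverseˡ (f 0) , ℤP.+-inverseʳ (f 0)
+-inverse-at f (suc i) = ℤP.+-inverseˡ (f (suc i)) , ℤP.+-inverseʳ (f (suc i))

TruncRing : ℕ → CommutativeRing 0ℓ 0ℓ
TruncRing n = record
  { Carrier = PS ; _≈_ = λ f g → f ≈[ n ] g ; _+_ = _⊕_ ; _*_ = _⊛_ ; -_ = ⊝_
  ; 0# = constPS (+ 0) ; 1# = 1PS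
  ; isCommutativeRing = record
    { isRing = record
      { +-isAbelianGroup = record
        { isGroup = record
          { isMonoid = record
            { isSemigroup = record
              { isMagma = record
                { isEquivalence = record
                  { refl  = λ {f} → ≈-refl f
                  ; sym   = λ f≈g → mk≈ (λ i i≤n → ≡.sym (coeff f≈g i i≤n))
                  ; trans = λ f≈g g≈h → mk≈ (λ i i≤n → ≡.trans (coeff f≈g i i≤n) (coeff g≈h i i≤n)) }
                ; ∙-cong = λ f≈ g≈ → mk≈ (λ i i≤n → cong₂ ℤ._+_ (coeff f≈ i i≤n) (coeff g≈ i i≤n)) }
              ; assoc = λ f g h → pointwise (λ i → ℤP.+-assoc (f i) (g i) (h i)) }
            ; identity = (λ f → pointwise (λ i → proj₁ (+-identity-at f i)))
                       , (λ f → pointwise (λ i → proj₂ (+-identity-at f i))) }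
          ; inverse = (λ f → pointwise (λ i → proj₁ (+-inverse-at f i)))
                    , (λ f → pointwise (λ i → proj₂ (+-inverse-at f i)))
          ; ⁻¹-cong = λ f≈ → mk≈ (λ i i≤n → cong ℤ.-_ (coeff f≈ i i≤n)) }
        ; comm = λ f g → pointwise (λ i → ℤP.+-comm (f i) (g i)) }
      ; *-cong = ⊛-cong
      ; *-assoc = λ f g h → pointwise (⊛-assoc f g h)
      ; *-identity = (λ f → pointwise (⊛-identityˡ f)) , (λ f → pointwise (⊛-identityʳ f))
      ; distrib = (λ f g h → pointwise (⊛-distribˡ f g h)) , (λ f g h → pointwise (⊛-distribʳ f g h)) }
    ; *-comm = λ f g → pointwise (⊛-comm f g) } }

module Trunc (n : ℕ) where
  open CommutativeRing (TruncRing n) public hiding (zero; refl)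
  open import Relation.Binary.Reasoning.Setoid setoid public

module TruncSolver (n : ℕ) where
  const-+ : ∀ a b i → constPS (a ℤ.+ b) i ≡ (constPS a ⊕ constPS b) i
  const-+ a b zero    = refl
  const-+ a b (suc i) = refl

  const-* : ∀ a b i → constPS (a ℤ.* b) i ≡ (constPS a ⊛ constPS b) i
  const-* a b zero    = ≡.sym (ℤP.+-identityʳ _)
  const-* a b (suc i) = ≡.sym (cong₂ ℤ._+_ (ℤP.*-zeroʳ a) (∑-zero (suc i) (λ _ _ → refl)))

  const-neg : ∀ a i → constPS (ℤ.- a) i ≡ (⊝ constPS a) i
  const-neg a zero    = refl
  const-neg a (suc i) = refl

  constHom : ℤ.+-*-rawRing -Raw-AlmostCommutative⟶ fromCommutativeRing (TruncRing n)
  constHom = record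
    { ⟦_⟧ = constPS
    ; +-homo = λ a b → pointwise (const-+ a b)
    ; *-homo = λ a b → pointwise (const-* a b)
    ; -‿homo = λ a → pointwise (const-neg a)
    ; 0-homo = mk≈ (λ _ _ → refl)
    ; 1-homo = mk≈ (λ _ _ → refl) }

  const-≟ : (a b : ℤ) → Maybe (constPS a ≈[ n ] constPS b)
  const-≟ a b with a ℤ.≟ b
  ... | yes refl = just (mk≈ (λ _ _ → refl))
  ... | no  _    = nothing

  open Algebra.Solver.Ring ℤ.+-*-rawRing (fromCommutativeRing (TruncRing n)) constHom const-≟ public
    using (solve; _:+_; _:*_; _:-_; con; _:=_)

qpow-same : ∀ k → qpow k k ≡ + 1
qpow-same k with k ℕ.≟ k
... | yes _  = refl
... | no k≢k = ⊥-elim (k≢k refl)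

qpow-other : ∀ k i → i ≢ k → qpow k i ≡ + 0
qpow-other k i i≢k with i ℕ.≟ k
... | yes i≡k = ⊥-elim (i≢k i≡k)
... | no  _   = refl

qpow-zero : ∀ i → qpow 0 i ≡ 1PS i
qpow-zero zero    = qpow-same 0
qpow-zero (suc i) = qpow-other 0 (suc i) (λ ())

∑-qpow-outside : ∀ N k (G : ℕ → ℤ) → N ≤ k → ∑ N (λ a → qpow k a ℤ.* G a) ≡ + 0
∑-qpow-outside zero    k G _   = refl
∑-qpow-outside (suc N) k G N<k = begin
    ∑ (suc N) (λ a → qpow k a ℤ.* G a)
  ≡⟨ ∑-last N (λ a → qpow k a ℤ.* G a) ⟩
    ∑ N (λ a → qpow k a ℤ.* G a) ℤ.+ qpow k N ℤ.* G N
  ≡⟨ cong₂ (λ x y → x ℤ.+ y ℤ.* G N) (∑-qpow-outside N k G (ℕP.≤-trans (ℕP.n≤1+n N) N<k))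
                                     (qpow-other k N (ℕP.<⇒≢ N<k)) ⟩
    + 0
  ∎ where open ≡.≡-Reasoning

∑-qpow-inside : ∀ N k (G : ℕ → ℤ) → k < N → ∑ N (λ a → qpow k a ℤ.* G a) ≡ G k
∑-qpow-inside (suc N) k G k<1+N = begin
    ∑ (suc N) (λ a → qpow k a ℤ.* G a)
  ≡⟨ ∑-last N (λ a → qpow k a ℤ.* G a) ⟩
    ∑ N (λ a → qpow k a ℤ.* G a) ℤ.+ qpow k N ℤ.* G N
  ≡⟨ lastSplit (ℕP.m≤n⇒m<n∨m≡n (ℕP.≤-pred k<1+N)) ⟩
    G k
  ∎ where
  open ≡.≡-Reasoning
  lastSplit : k < N ⊎ k ≡ N → ∑ N (λ a → qpow k a ℤ.* G a) ℤ.+ qpow k N ℤ.* G N ≡ G k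
  lastSplit (inj₁ k<N) = ≡.trans
    (cong₂ (λ x y → x ℤ.+ y ℤ.* G N) (∑-qpow-inside N k G k<N) (qpow-other k N (λ N≡k → ℕP.<⇒≢ k<N (≡.sym N≡k))))
    (ℤP.+-identityʳ (G k))
  lastSplit (inj₂ refl) = ≡.trans
    (cong₂ (λ x y → x ℤ.+ y ℤ.* G N) (∑-qpow-outside N N G ℕP.≤-refl) (qpow-same N))
    (≡.trans (ℤP.+-identityˡ _) (ℤP.*-identityˡ (G N)))

qpow-shift : ∀ k f i → k ≤ i → (qpow k ⊛ f) i ≡ f (i ∸ k)
qpow-shift k f i k≤i = ∑-qpow-inside (suc i) k (λ a → f (i ∸ a)) (s≤s k≤i)

qpow-shift-low : ∀ k f i → i < k → (qpow k ⊛ f) i ≡ + 0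
qpow-shift-low k f i i<k = ∑-qpow-outside (suc i) k (λ a → f (i ∸ a)) i<k

qpow-+ : ∀ a b i → qpow (a ℕ.+ b) i ≡ (qpow a ⊛ qpow b) i
qpow-+ a b i with a ℕ.≤? i
... | no a≰i = ≡.trans
  (qpow-other (a ℕ.+ b) i (λ i≡a+b → a≰i (ℕP.≤-trans (ℕP.m≤m+n a b) (ℕP.≤-reflexive (≡.sym i≡a+b)))))
  (≡.sym (qpow-shift-low a (qpow b) i (ℕP.≰⇒> a≰i)))
... | yes a≤i = ≡.trans (shifted (i ∸ a ℕ.≟ b)) (≡.sym (qpow-shift a (qpow b) i a≤i))
  where
  shifted : Dec (i ∸ a ≡ b) → qpow (a ℕ.+ b) i ≡ qpow b (i ∸ a)
  shifted (yes i-a≡b) = ≡.trans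
    (cong (qpow (a ℕ.+ b)) (≡.trans (≡.sym (ℕP.m+[n∸m]≡n a≤i)) (cong (a ℕ.+_) i-a≡b)))
    (≡.trans (qpow-same (a ℕ.+ b)) (≡.trans (≡.sym (qpow-same b)) (cong (qpow b) (≡.sym i-a≡b))))
  shifted (no i-a≢b) = ≡.trans
    (qpow-other (a ℕ.+ b) i (λ i≡a+b → i-a≢b (≡.trans (cong (_∸ a) i≡a+b) (ℕP.m+n∸m≡n a b))))
    (≡.sym (qpow-other b (i ∸ a) i-a≢b))

-- VanishesBelow v f : f is divisible by q^v (all coefficients below v are zero).
-- Used to show that the tails of the q-series sums do not affect low degrees.
VanishesBelow : ℕ → PS → Set
VanishesBelow v f = ∀ i → i < v → f i ≡ + 0

vanishes-mono : ∀ {v w f} → w ≤ v → VanishesBelow v f → VanishesBelow w f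
vanishes-mono w≤v f0 i i<w = f0 i (ℕP.≤-trans i<w w≤v)

vanishes-qpow : ∀ k → VanishesBelow k (qpow k)
vanishes-qpow k i i<k = qpow-other k i (ℕP.<⇒≢ i<k)

vanishes-⊛ : ∀ {v f} g → VanishesBelow v f → VanishesBelow v (f ⊛ g)
vanishes-⊛ {v} {f} g f0 i i<v =
  ∑-zero (suc i) (λ a a≤i → ≡.trans (cong (ℤ._* g (i ∸ a)) (f0 a (ℕP.≤-<-trans (ℕP.≤-pred a≤i) i<v)))
                                    (ℤP.*-zeroˡ (g (i ∸ a))))

vanishes-sumPS : ∀ {v} K F → (∀ j → j < K → VanishesBelow v (F j)) → VanishesBelow v (sumPS K F)
vanishes-sumPS zero    F F0 i i<v = refl
vanishes-sumPS (suc K) F F0 i i<v =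
  cong₂ ℤ._+_ (vanishes-sumPS K F (λ j j<K → F0 j (ℕP.≤-trans j<K (ℕP.n≤1+n K))) i i<v)
              (F0 K ℕP.≤-refl i i<v)

vanishes⇒≈0 : ∀ {n f} → VanishesBelow (suc n) f → f ≈[ n ] constPS (+ 0)
vanishes⇒≈0 f0 = mk≈ λ { zero _ → f0 zero (s≤s z≤n) ; (suc i) i<n → f0 (suc i) (s≤s i<n) }

-- The recursion defining inv f unfolds to  g (n+1) = - Σ_{i ≤ n} f (i+1) g (n-i),
-- which is exactly the statement that f ⊛ inv f = 1 when f 0 = 1.
∑-zipWith : ∀ k (F G : ℕ → ℤ) →
  sum (zipWith ℤ._*_ (applyUpTo F k) (applyUpTo G k)) ≡ ∑ k (λ i → F i ℤ.* G i)
∑-zipWith zero    F G = refl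
∑-zipWith (suc k) F G = cong (ℤ._+_ (F 0 ℤ.* G 0)) (∑-zipWith k (F ∘ suc) (G ∘ suc))

invList-coeffs : ∀ f n → invList f n ≡ applyUpTo (λ i → inv f (n ∸ i)) (suc n)
invList-coeffs f zero    = refl
invList-coeffs f (suc n) = cong (inv f (suc n) ∷_) (invList-coeffs f n)

inv-suc : ∀ f n → inv f (suc n) ≡ ℤ.- ∑ (suc n) (λ i → f (suc i) ℤ.* inv f (n ∸ i))
inv-suc f n = ≡.trans
  (cong (λ l → ℤ.- sum (zipWith ℤ._*_ (applyUpTo (λ i → f (suc i)) (suc n)) l)) (invList-coeffs f n))
  (cong ℤ.-_ (∑-zipWith (suc n) (λ i → f (suc i)) (λ i → inv f (n ∸ i))))

inv-inverseʳ : ∀ f → f 0 ≡ + 1 → ∀ i → (f ⊛ inv f) i ≡ 1PS i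
inv-inverseʳ f f0≡1 zero    = cong (λ x → x ℤ.* + 1 ℤ.+ + 0) f0≡1
inv-inverseʳ f f0≡1 (suc n) = begin
    f 0 ℤ.* inv f (suc n) ℤ.+ X
  ≡⟨ cong₂ (λ a b → a ℤ.* b ℤ.+ X) f0≡1 (inv-suc f n) ⟩
    + 1 ℤ.* (ℤ.- X) ℤ.+ X
  ≡⟨ cong (ℤ._+ X) (ℤP.*-identityˡ (ℤ.- X)) ⟩
    ℤ.- X ℤ.+ X
  ≡⟨ ℤP.+-inverseˡ X ⟩
    + 0
  ∎ where
  open ≡.≡-Reasoning
  X = ∑ (suc n) (λ i → f (suc i) ℤ.* inv f (n ∸ i))

inverse-unique : ∀ {n} a b c → a ⊛ b ≈[ n ] 1PS → a ⊛ c ≈[ n ] 1PS → b ≈[ n ] c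
inverse-unique {n} a b c ab≈1 ac≈1 = begin
    b               ≈⟨ sym (*-identityʳ b) ⟩
    b ⊛ 1PS         ≈⟨ *-congˡ {b} (sym ac≈1) ⟩
    b ⊛ (a ⊛ c)     ≈⟨ sym (*-assoc b a c) ⟩
    (b ⊛ a) ⊛ c     ≈⟨ *-congʳ (*-comm b a) ⟩
    (a ⊛ b) ⊛ c     ≈⟨ *-congʳ ab≈1 ⟩
    1PS ⊛ c         ≈⟨ *-identityˡ c ⟩
    c ∎ where open Trunc n

inv-inverse : ∀ {n} f → f 0 ≡ + 1 → f ⊛ inv f ≈[ n ] 1PS
inv-inverse f f0≡1 = pointwise (inv-inverseʳ f f0≡1)

invPoch : ℕ → PS
invPoch k = inv (qqPoch k)

invOneMinus : ℕ → PS
invOneMinus d = inv (1PS ⊖ qpow d)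

oneMinus-const : ∀ d → (1PS ⊖ qpow (suc d)) 0 ≡ + 1
oneMinus-const d = cong (λ y → + 1 ℤ.+ ℤ.- y) (qpow-other (suc d) 0 (λ ()))

qqPoch-const : ∀ k → qqPoch k 0 ≡ + 1
qqPoch-const zero    = refl
qqPoch-const (suc k) = cong₂ (λ x y → x ℤ.* y ℤ.+ + 0) (qqPoch-const k) (oneMinus-const k)

qqPoch-invPoch : ∀ {n} k → qqPoch k ⊛ invPoch k ≈[ n ] 1PS
qqPoch-invPoch k = inv-inverse (qqPoch k) (qqPoch-const k)

oneMinus-invOneMinus : ∀ {n} d → (1PS ⊖ qpow (suc d)) ⊛ invOneMinus (suc d) ≈[ n ] 1PS
oneMinus-invOneMinus d = inv-inverse (1PS ⊖ qpow (suc d)) (oneMinus-const d)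

invPoch-zero : ∀ {n} → invPoch 0 ≈[ n ] 1PS
invPoch-zero {n} = inverse-unique 1PS (invPoch 0) 1PS (qqPoch-invPoch 0) (pointwise (⊛-identityˡ 1PS))

invPoch-step : ∀ {n} k → invPoch k ≈[ n ] (1PS ⊖ qpow (suc k)) ⊛ invPoch (suc k)
invPoch-step {n} k = inverse-unique (qqPoch k) _ _ (qqPoch-invPoch k) (begin
    qqPoch k ⊛ ((1PS ⊖ qpow (suc k)) ⊛ invPoch (suc k)) ≈⟨ sym (*-assoc (qqPoch k) _ _) ⟩
    qqPoch (suc k) ⊛ invPoch (suc k)                     ≈⟨ qqPoch-invPoch (suc k) ⟩
    1PS ∎)
  where open Trunc n

-- For N ≥ n, (q;q)_N and hence 1/(q;q)_N agree with (q;q)_n, resp. 1/(q;q)_n,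
-- up to degree n: this is what makes 1/(q;q)_∞ the coefficientwise limit of 1/(q;q)_N.
oneMinus≈1 : ∀ {n} k → n < k → (1PS ⊖ qpow k) ≈[ n ] 1PS
oneMinus≈1 k n<k = mk≈ λ i i≤n →
  ≡.trans (cong (λ y → 1PS i ℤ.+ ℤ.- y) (vanishes-qpow k i (ℕP.≤-<-trans i≤n n<k))) (ℤP.+-identityʳ (1PS i))

qqPoch-stable : ∀ n t → qqPoch (n ℕ.+ t) ≈[ n ] qqPoch n
qqPoch-stable n zero    = ≡⇒≈ (cong qqPoch (ℕP.+-identityʳ n))
qqPoch-stable n (suc t) = begin
    qqPoch (n ℕ.+ suc t)     ≈⟨ ≡⇒≈ (cong qqPoch (ℕP.+-suc n t)) ⟩
    qqPoch (suc (n ℕ.+ t))   ≈⟨ *-congˡ {qqPoch (n ℕ.+ t)} (oneMinus≈1 (suc (n ℕ.+ t)) (s≤s (ℕP.m≤m+n n t))) ⟩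
    qqPoch (n ℕ.+ t) ⊛ 1PS   ≈⟨ *-identityʳ _ ⟩
    qqPoch (n ℕ.+ t)         ≈⟨ qqPoch-stable n t ⟩
    qqPoch n ∎ where open Trunc n

invPoch-stable : ∀ n k → n ≤ k → invPoch k ≈[ n ] invPoch n
invPoch-stable n k n≤k = inverse-unique (qqPoch n) (invPoch k) (invPoch n)
  (begin qqPoch n ⊛ invPoch k ≈⟨ *-congʳ (sym qqPoch-k≈n) ⟩
         qqPoch k ⊛ invPoch k ≈⟨ qqPoch-invPoch k ⟩
         1PS ∎)
  (qqPoch-invPoch n)
  where
  open Trunc n
  qqPoch-k≈n : qqPoch k ≈[ n ] qqPoch n
  qqPoch-k≈n = trans (≡⇒≈ (cong qqPoch (≡.sym (ℕP.m+[n∸m]≡n n≤k)))) (qqPoch-stable n (k ∸ n))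

qbinom-unfold : ∀ N k → k ≤ N → ∀ i → qbinom N k i ≡ (qqPoch N ⊛ invPoch k ⊛ invPoch (N ∸ k)) i
qbinom-unfold N k k≤N i with k ℕ.≤? N
... | yes _   = refl
... | no  k≰N = ⊥-elim (k≰N k≤N)

qbinom-vanish : ∀ N k → ¬ k ≤ N → ∀ i → qbinom N k i ≡ + 0
qbinom-vanish N k k≰N i with k ℕ.≤? N
... | yes k≤N = ⊥-elim (k≰N k≤N)
... | no  _   = refl

·-as-⊛ : ∀ {n} c f → c · f ≈[ n ] constPS c ⊛ f
·-as-⊛ c f = pointwise λ i → ≡.sym (≡.trans
  (cong (ℤ._+_ (c ℤ.* f i)) (∑-zero i {λ a → constPS c (suc a) ℤ.* f (i ∸ suc a)} (λ _ _ → refl)))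
  (ℤP.+-identityʳ _))

zero-series : ∀ {n} → (λ (_ : ℕ) → + 0) ≈[ n ] constPS (+ 0)
zero-series = mk≈ λ { zero _ → refl ; (suc i) _ → refl }

sumPS-cong : ∀ {n} K {F G} → (∀ j → j < K → F j ≈[ n ] G j) → sumPS K F ≈[ n ] sumPS K G
sumPS-cong zero    F≈G = mk≈ λ _ _ → refl
sumPS-cong (suc K) F≈G = mk≈ λ i i≤n →
  cong₂ ℤ._+_ (coeff (sumPS-cong K (λ j j<K → F≈G j (ℕP.≤-trans j<K (ℕP.n≤1+n K)))) i i≤n)
              (coeff (F≈G K ℕP.≤-refl) i i≤n)

sumPS-⊕ : ∀ {n} K F G → sumPS K (λ j → F j ⊕ G j) ≈[ n ] sumPS K F ⊕ sumPS K G
sumPS-⊕ zero    F G = mk≈ λ _ _ → refl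
sumPS-⊕ {n} (suc K) F G = begin
    sumPS K (λ j → F j ⊕ G j) ⊕ (F K ⊕ G K)        ≈⟨ +-congʳ (sumPS-⊕ K F G) ⟩
    (sumPS K F ⊕ sumPS K G) ⊕ (F K ⊕ G K)          ≈⟨ solve 4 (λ a b c d → (a :+ b) :+ (c :+ d) := (a :+ c) :+ (b :+ d))
                                                             (≈-refl _) (sumPS K F) (sumPS K G) (F K) (G K) ⟩
    (sumPS K F ⊕ F K) ⊕ (sumPS K G ⊕ G K) ∎
  where
  open Trunc n
  open TruncSolver n

sumPS-⊛ : ∀ {n} K a F → sumPS K (λ j → a ⊛ F j) ≈[ n ] a ⊛ sumPS K F
sumPS-⊛ {n} zero    a F = begin
    sumPS zero (λ j → a ⊛ F j) ≈⟨ zero-series ⟩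
    constPS (+ 0)              ≈⟨ sym (zeroʳ a) ⟩
    a ⊛ constPS (+ 0)          ≈⟨ *-congˡ {a} (sym zero-series) ⟩
    a ⊛ sumPS zero F ∎ where open Trunc n
sumPS-⊛ {n} (suc K) a F = begin
    sumPS K (λ j → a ⊛ F j) ⊕ a ⊛ F K ≈⟨ +-congʳ (sumPS-⊛ K a F) ⟩
    a ⊛ sumPS K F ⊕ a ⊛ F K           ≈⟨ sym (distribˡ a _ _) ⟩
    a ⊛ (sumPS K F ⊕ F K) ∎ where open Trunc n

sumPS-split : ∀ a b F i → sumPS (a ℕ.+ b) F i ≡ (sumPS a F ⊕ sumPS b (λ j → F (a ℕ.+ j))) i
sumPS-split a zero    F i = ≡.trans (cong (λ k → sumPS k F i) (ℕP.+-identityʳ a)) (≡.sym (ℤP.+-identityʳ _))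
sumPS-split a (suc b) F i = ≡.trans (cong (λ k → sumPS k F i) (ℕP.+-suc a b))
  (≡.trans (cong (ℤ._+ F (a ℕ.+ b) i) (sumPS-split a b F i)) (ℤP.+-assoc (sumPS a F i) _ _))

sumPS-first : ∀ {n} K F → sumPS (suc K) F ≈[ n ] F 0 ⊕ sumPS K (F ∘ suc)
sumPS-first K F = pointwise λ i →
  ≡.trans (sumPS-split 1 K F i) (cong (ℤ._+ sumPS K (F ∘ suc) i) (ℤP.+-identityˡ (F 0 i)))

sumPS-vanish : ∀ {n} K F → (∀ j → j < K → F j ≈[ n ] constPS (+ 0)) → sumPS K F ≈[ n ] constPS (+ 0)
sumPS-vanish zero    F F≈0 = zero-series
sumPS-vanish {n} (suc K) F F≈0 = begin
    sumPS K F ⊕ F K               ≈⟨ +-cong (sumPS-vanish K F (λ j j<K → F≈0 j (ℕP.≤-trans j<K (ℕP.n≤1+n K))))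
                                            (F≈0 K ℕP.≤-refl) ⟩
    constPS (+ 0) ⊕ constPS (+ 0) ≈⟨ +-identityˡ _ ⟩
    constPS (+ 0) ∎ where open Trunc n

-- If the j-th summand is divisible by q^j, the sum stabilises below degree n+1
-- once n+1 summands are taken: the q-adic convergence of the series used below.
sumPS-stable : ∀ n K F → (∀ j → VanishesBelow j (F j)) → suc n ≤ K → sumPS K F ≈[ n ] sumPS (suc n) F
sumPS-stable n K F F0 n<K = begin
    sumPS K F
  ≈⟨ ≡⇒≈ (cong (λ k → sumPS k F) (≡.sym (ℕP.m+[n∸m]≡n n<K))) ⟩
    sumPS (suc n ℕ.+ (K ∸ suc n)) F
  ≈⟨ pointwise (sumPS-split (suc n) (K ∸ suc n) F) ⟩
    sumPS (suc n) F ⊕ sumPS (K ∸ suc n) (λ j → F (suc n ℕ.+ j))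
  ≈⟨ +-congˡ {sumPS (suc n) F} (vanishes⇒≈0 (vanishes-sumPS (K ∸ suc n) (λ j → F (suc n ℕ.+ j))
       (λ j _ → vanishes-mono (ℕP.m≤m+n (suc n) j) (F0 (suc n ℕ.+ j))))) ⟩
    sumPS (suc n) F ⊕ constPS (+ 0)
  ≈⟨ +-identityʳ _ ⟩
    sumPS (suc n) F ∎ where open Trunc n

-- Durfee-type sums.  The j-th term  q^(j² + a j) / ((q;q)_j (q;q)_(j+b))  is
-- divisible by q^j, so the series  Σ_j  converges q-adically; J-th partial sum:
durfeeTerm : ℕ → ℕ → ℕ → PS
durfeeTerm a b j = qpow (j ℕ.* j ℕ.+ a ℕ.* j) ⊛ invPoch j ⊛ invPoch (j ℕ.+ b)

durfeeSum : ℕ → ℕ → ℕ → PS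
durfeeSum a b J = sumPS J (durfeeTerm a b)

qpow-≡ : ∀ {n} {a b} → a ≡ b → qpow a ≈[ n ] qpow b
qpow-≡ refl = ≈-refl _

invPoch-≡ : ∀ {n} {a b} → a ≡ b → invPoch a ≈[ n ] invPoch b
invPoch-≡ refl = ≈-refl _

qpow-split : ∀ {n} a b → qpow (a ℕ.+ b) ≈[ n ] qpow a ⊛ qpow b
qpow-split a b = pointwise (qpow-+ a b)

oneMinus-cong : ∀ {n a} {x : PS} → qpow a ≈[ n ] x → (1PS ⊖ qpow a) ≈[ n ] (1PS ⊖ x)
oneMinus-cong {n} a≈x = Trunc.+-cong n (≈-refl 1PS) (Trunc.-‿cong n a≈x)

j≤j*j : ∀ j → j ≤ j ℕ.* j
j≤j*j zero    = z≤n
j≤j*j (suc j) = ℕP.m≤m+n (suc j) (j ℕ.* suc j)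

durfeeTerm-vanishes : ∀ a b j → VanishesBelow j (durfeeTerm a b j)
durfeeTerm-vanishes a b j = vanishes-mono (ℕP.≤-trans (j≤j*j j) (ℕP.m≤m+n (j ℕ.* j) (a ℕ.* j)))
  (vanishes-⊛ (invPoch (j ℕ.+ b)) (vanishes-⊛ (invPoch j) (vanishes-qpow _)))

durfeeSum-stable : ∀ n a b J → suc n ≤ J → durfeeSum a b J ≈[ n ] durfeeSum a b (suc n)
durfeeSum-stable n a b J = sumPS-stable n J (durfeeTerm a b) (durfeeTerm-vanishes a b)

exponent-shift : ∀ a j → j ℕ.* j ℕ.+ suc a ℕ.* j ≡ (j ℕ.* j ℕ.+ a ℕ.* j) ℕ.+ j
exponent-shift = solve 2 (λ a j → j :* j :+ (j :+ a :* j) := (j :* j :+ a :* j) :+ j) refl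
  where open ℕSolver.+-*-Solver

-- First recurrence, termwise:  T(a, b+1, j) = T(a, b, j) + q^(b+1) T(a+1, b+1, j),
-- from  1/(q;q)_(j+b) = (1 - q^(j+b+1)) / (q;q)_(j+b+1).
durfeeTerm-rec₁ : ∀ {n} a b j →
  durfeeTerm a (suc b) j ≈[ n ] durfeeTerm a b j ⊕ qpow (suc b) ⊛ durfeeTerm (suc a) (suc b) j
durfeeTerm-rec₁ {n} a b j = sym (begin
    E ⊛ X ⊛ Y ⊕ Qb ⊛ (qpow (j ℕ.* j ℕ.+ suc a ℕ.* j) ⊛ X ⊛ Z)
  ≈⟨ +-cong (⊛-cong (≈-refl (E ⊛ X)) Y≈) (⊛-cong (≈-refl Qb) (⊛-cong (⊛-cong E′≈ (≈-refl X)) (≈-refl Z))) ⟩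
    E ⊛ X ⊛ ((1PS ⊖ Qj ⊛ Qb) ⊛ Z) ⊕ Qb ⊛ (E ⊛ Qj ⊛ X ⊛ Z)
  ≈⟨ solve 5 (λ E X Z Qj Qb → E :* X :* ((con (+ 1) :- Qj :* Qb) :* Z) :+ Qb :* (E :* Qj :* X :* Z)
                := E :* X :* Z) (≈-refl _) E X Z Qj Qb ⟩
    E ⊛ X ⊛ Z
  ∎)
  where
  open Trunc n
  open TruncSolver n
  E = qpow (j ℕ.* j ℕ.+ a ℕ.* j)
  X = invPoch j
  Y = invPoch (j ℕ.+ b)
  Z = invPoch (j ℕ.+ suc b)
  Qj = qpow j
  Qb = qpow (suc b)
  Y≈ : Y ≈[ n ] (1PS ⊖ Qj ⊛ Qb) ⊛ Z
  Y≈ = trans (invPoch-step (j ℕ.+ b))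
             (⊛-cong (oneMinus-cong (trans (qpow-≡ (≡.sym (ℕP.+-suc j b))) (qpow-split j (suc b))))
                     (invPoch-≡ (≡.sym (ℕP.+-suc j b))))
  E′≈ : qpow (j ℕ.* j ℕ.+ suc a ℕ.* j) ≈[ n ] E ⊛ Qj
  E′≈ = trans (qpow-≡ (exponent-shift a j)) (qpow-split _ j)

exponent-step : ∀ a j → suc a ℕ.+ (j ℕ.* j ℕ.+ suc (suc a) ℕ.* j) ≡ suc j ℕ.* suc j ℕ.+ a ℕ.* suc j
exponent-step = solve 2 (λ a j → (con 1 :+ a) :+ (j :* j :+ (con 2 :+ a) :* j)
                                 := (con 1 :+ j) :* (con 1 :+ j) :+ a :* (con 1 :+ j)) refl
  where open ℕSolver.+-*-Solver

-- Second recurrence, termwise: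
--   T(a, b, j+1) = T(a+1, b, j+1) + q^(a+1) T(a+2, b+1, j),
-- from  1/(q;q)_j = (1 - q^(j+1)) / (q;q)_(j+1).
durfeeTerm-rec₂ : ∀ {n} a b j →
  durfeeTerm a b (suc j) ≈[ n ] durfeeTerm (suc a) b (suc j) ⊕ qpow (suc a) ⊛ durfeeTerm (suc (suc a)) (suc b) j
durfeeTerm-rec₂ {n} a b j = sym (begin
    qpow (suc j ℕ.* suc j ℕ.+ suc a ℕ.* suc j) ⊛ X₁ ⊛ Y₁ ⊕ Qa ⊛ (F ⊛ X₀ ⊛ invPoch (j ℕ.+ suc b))
  ≈⟨ +-cong (⊛-cong (⊛-cong (trans (qpow-≡ (exponent-shift a (suc j))) (qpow-split (suc j ℕ.* suc j ℕ.+ a ℕ.* suc j) (suc j))) (≈-refl X₁)) (≈-refl Y₁))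
            (⊛-cong (≈-refl Qa) (⊛-cong (⊛-cong (≈-refl F) (invPoch-step j)) (invPoch-≡ (ℕP.+-suc j b)))) ⟩
    E ⊛ Qs ⊛ X₁ ⊛ Y₁ ⊕ Qa ⊛ (F ⊛ ((1PS ⊖ Qs) ⊛ X₁) ⊛ Y₁)
  ≈⟨ solve 6 (λ E Qs X₁ Y₁ Qa F → E :* Qs :* X₁ :* Y₁ :+ Qa :* (F :* ((con (+ 1) :- Qs) :* X₁) :* Y₁)
                := E :* Qs :* X₁ :* Y₁ :+ (Qa :* F) :* ((con (+ 1) :- Qs) :* X₁ :* Y₁)) (≈-refl _) E Qs X₁ Y₁ Qa F ⟩
    E ⊛ Qs ⊛ X₁ ⊛ Y₁ ⊕ (Qa ⊛ F) ⊛ ((1PS ⊖ Qs) ⊛ X₁ ⊛ Y₁)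
  ≈⟨ +-congˡ {E ⊛ Qs ⊛ X₁ ⊛ Y₁} (⊛-cong (trans (sym (qpow-split (suc a) _)) (qpow-≡ (exponent-step a j)))
                                        (≈-refl ((1PS ⊖ Qs) ⊛ X₁ ⊛ Y₁))) ⟩
    E ⊛ Qs ⊛ X₁ ⊛ Y₁ ⊕ E ⊛ ((1PS ⊖ Qs) ⊛ X₁ ⊛ Y₁)
  ≈⟨ solve 4 (λ E Qs X₁ Y₁ → E :* Qs :* X₁ :* Y₁ :+ E :* ((con (+ 1) :- Qs) :* X₁ :* Y₁) := E :* X₁ :* Y₁)
             (≈-refl _) E Qs X₁ Y₁ ⟩
    E ⊛ X₁ ⊛ Y₁
  ∎)
  where
  open Trunc n
  open TruncSolver n
  E = qpow (suc j ℕ.* suc j ℕ.+ a ℕ.* suc j)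
  X₁ = invPoch (suc j)
  Y₁ = invPoch (suc j ℕ.+ b)
  X₀ = invPoch j
  Qs = qpow (suc j)
  Qa = qpow (suc a)
  F = qpow (j ℕ.* j ℕ.+ suc (suc a) ℕ.* j)

durfeeSum-rec₁ : ∀ {n} a b J →
  durfeeSum a (suc b) J ≈[ n ] durfeeSum a b J ⊕ qpow (suc b) ⊛ durfeeSum (suc a) (suc b) J
durfeeSum-rec₁ {n} a b J = begin
    sumPS J (durfeeTerm a (suc b))
  ≈⟨ sumPS-cong J (λ j _ → durfeeTerm-rec₁ a b j) ⟩
    sumPS J (λ j → durfeeTerm a b j ⊕ qpow (suc b) ⊛ durfeeTerm (suc a) (suc b) j)
  ≈⟨ sumPS-⊕ J (durfeeTerm a b) (λ j → qpow (suc b) ⊛ durfeeTerm (suc a) (suc b) j) ⟩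
    durfeeSum a b J ⊕ sumPS J (λ j → qpow (suc b) ⊛ durfeeTerm (suc a) (suc b) j)
  ≈⟨ +-congˡ {durfeeSum a b J} (sumPS-⊛ J (qpow (suc b)) (durfeeTerm (suc a) (suc b))) ⟩
    durfeeSum a b J ⊕ qpow (suc b) ⊛ durfeeSum (suc a) (suc b) J
  ∎ where open Trunc n

durfeeSum-rec₂ : ∀ {n} a b J →
  durfeeSum a b (suc J) ≈[ n ] durfeeSum (suc a) b (suc J) ⊕ qpow (suc a) ⊛ durfeeSum (suc (suc a)) (suc b) J
durfeeSum-rec₂ {n} a b J = begin
    durfeeSum a b (suc J)
  ≈⟨ sumPS-first J (durfeeTerm a b) ⟩
    T₀ ⊕ sumPS J (durfeeTerm a b ∘ suc)
  ≈⟨ +-congˡ {T₀} (sumPS-cong J (λ j _ → durfeeTerm-rec₂ a b j)) ⟩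
    T₀ ⊕ sumPS J (λ j → durfeeTerm (suc a) b (suc j) ⊕ Qa ⊛ durfeeTerm (suc (suc a)) (suc b) j)
  ≈⟨ +-congˡ {T₀} (sumPS-⊕ J (durfeeTerm (suc a) b ∘ suc) (λ j → Qa ⊛ durfeeTerm (suc (suc a)) (suc b) j)) ⟩
    T₀ ⊕ (sumPS J (durfeeTerm (suc a) b ∘ suc) ⊕ sumPS J (λ j → Qa ⊛ durfeeTerm (suc (suc a)) (suc b) j))
  ≈⟨ +-congˡ {T₀} (+-congˡ {sumPS J (durfeeTerm (suc a) b ∘ suc)} (sumPS-⊛ J Qa (durfeeTerm (suc (suc a)) (suc b)))) ⟩
    T₀ ⊕ (sumPS J (durfeeTerm (suc a) b ∘ suc) ⊕ Qa ⊛ durfeeSum (suc (suc a)) (suc b) J)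
  ≈⟨ sym (+-assoc T₀ _ _) ⟩
    (durfeeTerm (suc a) b 0 ⊕ sumPS J (durfeeTerm (suc a) b ∘ suc)) ⊕ Qa ⊛ durfeeSum (suc (suc a)) (suc b) J
  ≈⟨ +-congʳ (sym (sumPS-first J (durfeeTerm (suc a) b))) ⟩
    durfeeSum (suc a) b (suc J) ⊕ Qa ⊛ durfeeSum (suc (suc a)) (suc b) J
  ∎ where
  open Trunc n
  Qa = qpow (suc a)
  -- the j = 0 term does not depend on a
  T₀ = durfeeTerm a b 0

durfeeSum-rec₂-stable : ∀ {n} a b →
  durfeeSum a b (suc n) ≈[ n ] durfeeSum (suc a) b (suc n) ⊕ qpow (suc a) ⊛ durfeeSum (suc (suc a)) (suc b) (suc n)
durfeeSum-rec₂-stable {n} a b = begin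
    durfeeSum a b (suc n)
  ≈⟨ sym (durfeeSum-stable n a b (suc (suc n)) (ℕP.n≤1+n (suc n))) ⟩
    durfeeSum a b (suc (suc n))
  ≈⟨ durfeeSum-rec₂ a b (suc n) ⟩
    durfeeSum (suc a) b (suc (suc n)) ⊕ qpow (suc a) ⊛ durfeeSum (suc (suc a)) (suc b) (suc n)
  ≈⟨ +-congʳ (durfeeSum-stable n (suc a) b (suc (suc n)) (ℕP.n≤1+n (suc n))) ⟩
    durfeeSum (suc a) b (suc n) ⊕ qpow (suc a) ⊛ durfeeSum (suc (suc a)) (suc b) (suc n)
  ∎ where open Trunc n

-- Combining both recurrences, the diagonal sums do not depend on k:
--   Σ_j q^(j² + k j) / ((q;q)_j (q;q)_(j+k))  =  Σ_j q^(j² + (k+1) j) / ((q;q)_j (q;q)_(j+k+1)).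
durfeeSum-diag-step : ∀ {n} k → durfeeSum k k (suc n) ≈[ n ] durfeeSum (suc k) (suc k) (suc n)
durfeeSum-diag-step {n} k = Trunc.trans n (durfeeSum-rec₂-stable k k) (Trunc.sym n (durfeeSum-rec₁ (suc k) k (suc n)))

durfeeSum-diag-shift : ∀ {n} k t → durfeeSum k k (suc n) ≈[ n ] durfeeSum (k ℕ.+ t) (k ℕ.+ t) (suc n)
durfeeSum-diag-shift {n} k zero    = ≡⇒≈ (cong (λ x → durfeeSum x x (suc n)) (≡.sym (ℕP.+-identityʳ k)))
durfeeSum-diag-shift {n} k (suc t) = Trunc.trans n (durfeeSum-diag-shift k t)
  (Trunc.trans n (durfeeSum-diag-step (k ℕ.+ t)) (≡⇒≈ (cong (λ x → durfeeSum x x (suc n)) (≡.sym (ℕP.+-suc k t)))))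

-- For k ≥ n every term with j ≥ 1 is divisible by q^(n+1), leaving 1/(q;q)_k ≈ 1/(q;q)_n.
durfeeSum-diag-large : ∀ {n} K → n ≤ K → durfeeSum K K (suc n) ≈[ n ] invPoch n
durfeeSum-diag-large {n} K n≤K = begin
    durfeeSum K K (suc n)
  ≈⟨ sumPS-first n (durfeeTerm K K) ⟩
    durfeeTerm K K 0 ⊕ sumPS n (durfeeTerm K K ∘ suc)
  ≈⟨ +-cong (⊛-cong (⊛-cong (trans (qpow-≡ (ℕP.*-zeroʳ K)) (pointwise qpow-zero)) invPoch-zero) (invPoch-stable n K n≤K))
            (vanishes⇒≈0 (vanishes-sumPS n (durfeeTerm K K ∘ suc) (λ j _ →
               vanishes-mono (n<exponent j) (vanishes-⊛ (invPoch (suc j ℕ.+ K)) (vanishes-⊛ (invPoch (suc j)) (vanishes-qpow _)))))) ⟩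
    1PS ⊛ 1PS ⊛ invPoch n ⊕ constPS (+ 0)
  ≈⟨ solve 1 (λ x → con (+ 1) :* con (+ 1) :* x :+ con (+ 0) := x) (≈-refl _) (invPoch n) ⟩
    invPoch n ∎
  where
  open Trunc n
  open TruncSolver n
  n<exponent : ∀ j → suc n ≤ suc j ℕ.* suc j ℕ.+ K ℕ.* suc j
  n<exponent j = ℕP.≤-trans (s≤s (ℕP.≤-trans n≤K (ℕP.m≤m*n K (suc j)))) (ℕP.+-monoˡ-≤ (K ℕ.* suc j) (s≤s z≤n))

durfee-identity : ∀ {n} k → durfeeSum k k (suc n) ≈[ n ] invPoch n
durfee-identity {n} k = Trunc.trans n (durfeeSum-diag-shift k n) (durfeeSum-diag-large (k ℕ.+ n) (ℕP.m≤n+m n k))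

durfee-identity′ : ∀ {n} k → durfeeSum k (suc k) (suc n) ≈[ n ] (1PS ⊕ qpow (suc k)) ⊛ invPoch n
durfee-identity′ {n} k = begin
    durfeeSum k (suc k) (suc n)
  ≈⟨ durfeeSum-rec₁ k k (suc n) ⟩
    durfeeSum k k (suc n) ⊕ qpow (suc k) ⊛ durfeeSum (suc k) (suc k) (suc n)
  ≈⟨ +-cong (durfee-identity k) (⊛-cong (≈-refl (qpow (suc k))) (durfee-identity (suc k))) ⟩
    invPoch n ⊕ qpow (suc k) ⊛ invPoch n
  ≈⟨ solve 2 (λ x q → x :+ q :* x := (con (+ 1) :+ q) :* x) (≈-refl _) (invPoch n) (qpow (suc k)) ⟩
    (1PS ⊕ qpow (suc k)) ⊛ invPoch n ∎
  where
  open Trunc n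
  open TruncSolver n

rhsTerm : ℕ → ℕ → ℕ → PS
rhsTerm e m d = qpow e ⊛ invPoch (2 ℕ.* d) ⊛ (1PS ⊖ qpow m) ⊛ invOneMinus d ⊛ qbinom (2 ℕ.* d) (d ℕ.+ m)

rhsTerm-vanish : ∀ {n} e m d → d < m → rhsTerm e m d ≈[ n ] constPS (+ 0)
rhsTerm-vanish {n} e m d d<m = begin
    X ⊛ qbinom (2 ℕ.* d) (d ℕ.+ m) ≈⟨ ⊛-cong (≈-refl X) (trans (pointwise (qbinom-vanish (2 ℕ.* d) (d ℕ.+ m) d+m≰2d))
                                                               zero-series) ⟩
    X ⊛ constPS (+ 0)              ≈⟨ zeroʳ X ⟩
    constPS (+ 0) ∎
  where
  open Trunc n
  X = qpow e ⊛ invPoch (2 ℕ.* d) ⊛ (1PS ⊖ qpow m) ⊛ invOneMinus d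
  d+m≰2d : ¬ d ℕ.+ m ≤ 2 ℕ.* d
  d+m≰2d d+m≤2d = ℕP.<⇒≱ d<m (ℕP.≤-trans (ℕP.+-cancelˡ-≤ d m (d ℕ.+ 0) d+m≤2d) (ℕP.≤-reflexive (ℕP.+-identityʳ d)))

rhsTerm-simplify : ∀ {n} e m d → m ≤ d →
  rhsTerm e m d ≈[ n ] qpow e ⊛ (1PS ⊖ qpow m) ⊛ invOneMinus d ⊛ invPoch (d ℕ.+ m) ⊛ invPoch (d ∸ m)
rhsTerm-simplify {n} e m d m≤d = begin
    E ⊛ I₂ ⊛ O ⊛ V ⊛ qbinom (2 ℕ.* d) (d ℕ.+ m)
  ≈⟨ ⊛-cong (≈-refl (E ⊛ I₂ ⊛ O ⊛ V)) (trans (pointwise (qbinom-unfold (2 ℕ.* d) (d ℕ.+ m) d+m≤2d))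
                                             (⊛-cong (≈-refl (Q₂ ⊛ invPoch (d ℕ.+ m))) (invPoch-≡ 2d-[d+m]≡d-m))) ⟩
    E ⊛ I₂ ⊛ O ⊛ V ⊛ (Q₂ ⊛ invPoch (d ℕ.+ m) ⊛ invPoch (d ∸ m))
  ≈⟨ solve 7 (λ E I₂ O V Q₂ A B → E :* I₂ :* O :* V :* (Q₂ :* A :* B) := (Q₂ :* I₂) :* (E :* O :* V :* A :* B))
             (≈-refl _) E I₂ O V Q₂ (invPoch (d ℕ.+ m)) (invPoch (d ∸ m)) ⟩
    (Q₂ ⊛ I₂) ⊛ (E ⊛ O ⊛ V ⊛ invPoch (d ℕ.+ m) ⊛ invPoch (d ∸ m))
  ≈⟨ *-congʳ (qqPoch-invPoch (2 ℕ.* d)) ⟩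
    1PS ⊛ (E ⊛ O ⊛ V ⊛ invPoch (d ℕ.+ m) ⊛ invPoch (d ∸ m))
  ≈⟨ *-identityˡ _ ⟩
    E ⊛ O ⊛ V ⊛ invPoch (d ℕ.+ m) ⊛ invPoch (d ∸ m) ∎
  where
  open Trunc n
  open TruncSolver n
  E = qpow e
  I₂ = invPoch (2 ℕ.* d)
  Q₂ = qqPoch (2 ℕ.* d)
  O = 1PS ⊖ qpow m
  V = invOneMinus d
  d+m≤2d : d ℕ.+ m ≤ 2 ℕ.* d
  d+m≤2d = ℕP.+-monoʳ-≤ d (ℕP.≤-trans m≤d (ℕP.≤-reflexive (≡.sym (ℕP.+-identityʳ d))))
  2d-[d+m]≡d-m : 2 ℕ.* d ∸ (d ℕ.+ m) ≡ d ∸ m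
  2d-[d+m]≡d-m = ≡.trans (ℕP.[m+n]∸[m+o]≡n∸o d (d ℕ.+ 0) m) (cong (_∸ m) (ℕP.+-identityʳ d))

-- Two consecutive summands (parameters m = M and m = M+1, at the same d = M + j,
-- the second carrying an extra q^M) combine into one Durfee-type term:
--   q^e (1 - q^(2M+1)) / ((q;q)_j (q;q)_(j+2M+1)).
pairedTerm : ℕ → ℕ → ℕ → PS
pairedTerm e M j = qpow e ⊛ (1PS ⊖ qpow (suc (M ℕ.+ M))) ⊛ invPoch j ⊛ invPoch (suc (M ℕ.+ j ℕ.+ M))

-- j = 0: only the first summand survives
rhsTerm-pair₀ : ∀ {n} e m′ → let M = suc m′ in
  rhsTerm e M M ⊕ rhsTerm (e ℕ.+ M) (suc M) M ≈[ n ] pairedTerm e M 0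
rhsTerm-pair₀ {n} e m′ = trans summands (sym paired)
  where
  open Trunc n
  open TruncSolver n
  M = suc m′
  E = qpow e
  O = 1PS ⊖ qpow M
  O₂ = 1PS ⊖ qpow (suc (M ℕ.+ M))
  summands : rhsTerm e M M ⊕ rhsTerm (e ℕ.+ M) (suc M) M ≈[ n ] E ⊛ invPoch (M ℕ.+ M)
  summands = begin
      rhsTerm e M M ⊕ rhsTerm (e ℕ.+ M) (suc M) M
    ≈⟨ +-cong (rhsTerm-simplify e M M ℕP.≤-refl) (rhsTerm-vanish (e ℕ.+ M) (suc M) M ℕP.≤-refl) ⟩
      E ⊛ O ⊛ invOneMinus M ⊛ invPoch (M ℕ.+ M) ⊛ invPoch (M ∸ M) ⊕ constPS (+ 0)
    ≈⟨ +-congʳ (⊛-cong (≈-refl (E ⊛ O ⊛ invOneMinus M ⊛ invPoch (M ℕ.+ M)))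
                       (trans (invPoch-≡ (ℕP.n∸n≡0 M)) invPoch-zero)) ⟩
      E ⊛ O ⊛ invOneMinus M ⊛ invPoch (M ℕ.+ M) ⊛ 1PS ⊕ constPS (+ 0)
    ≈⟨ solve 4 (λ E O V I → E :* O :* V :* I :* con (+ 1) :+ con (+ 0) := (O :* V) :* (E :* I))
               (≈-refl _) E O (invOneMinus M) (invPoch (M ℕ.+ M)) ⟩
      (O ⊛ invOneMinus M) ⊛ (E ⊛ invPoch (M ℕ.+ M))
    ≈⟨ ⊛-cong (oneMinus-invOneMinus m′) (≈-refl (E ⊛ invPoch (M ℕ.+ M))) ⟩
      1PS ⊛ (E ⊛ invPoch (M ℕ.+ M))
    ≈⟨ *-identityˡ _ ⟩
      E ⊛ invPoch (M ℕ.+ M) ∎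
  paired : pairedTerm e M 0 ≈[ n ] E ⊛ invPoch (M ℕ.+ M)
  paired = begin
      E ⊛ O₂ ⊛ invPoch 0 ⊛ invPoch (suc (M ℕ.+ 0 ℕ.+ M))
    ≈⟨ ⊛-cong (⊛-cong (≈-refl (E ⊛ O₂)) invPoch-zero)
              (invPoch-≡ (cong (λ x → suc (x ℕ.+ M)) (ℕP.+-identityʳ M))) ⟩
      E ⊛ O₂ ⊛ 1PS ⊛ invPoch (suc (M ℕ.+ M))
    ≈⟨ solve 3 (λ E O B → E :* O :* con (+ 1) :* B := E :* (O :* B)) (≈-refl _) E O₂ (invPoch (suc (M ℕ.+ M))) ⟩
      E ⊛ (O₂ ⊛ invPoch (suc (M ℕ.+ M)))
    ≈⟨ *-congˡ {E} (sym (invPoch-step (M ℕ.+ M))) ⟩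
      E ⊛ invPoch (M ℕ.+ M) ∎

exponent-pair : ∀ M j → suc ((M ℕ.+ suc j) ℕ.+ M) ≡ ((M ℕ.+ M) ℕ.+ suc j) ℕ.+ 1
exponent-pair = solve 2 (λ M j → con 1 :+ ((M :+ (con 1 :+ j)) :+ M) := ((M :+ M) :+ (con 1 :+ j)) :+ con 1) refl
  where open ℕSolver.+-*-Solver

-- j ≥ 1: both summands simplify, and the sum factors through (1 - q^d)
rhsTerm-pair : ∀ {n} e m′ j → let M = suc m′ ; d = M ℕ.+ suc j in
  rhsTerm e M d ⊕ rhsTerm (e ℕ.+ M) (suc M) d ≈[ n ] pairedTerm e M (suc j)
rhsTerm-pair {n} e m′ j = begin
    rhsTerm e M d ⊕ rhsTerm (e ℕ.+ M) (suc M) d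
  ≈⟨ +-cong (rhsTerm-simplify e M d (ℕP.m≤m+n M (suc j)))
            (rhsTerm-simplify (e ℕ.+ M) (suc M) d (ℕP.≤-trans (ℕP.≤-reflexive (ℕP.+-comm 1 M)) (ℕP.+-monoʳ-≤ M (s≤s z≤n)))) ⟩
    E ⊛ O ⊛ V ⊛ invPoch (d ℕ.+ M) ⊛ invPoch (d ∸ M)
      ⊕ qpow (e ℕ.+ M) ⊛ (1PS ⊖ qpow (suc M)) ⊛ V ⊛ invPoch (d ℕ.+ suc M) ⊛ invPoch (d ∸ suc M)
  ≈⟨ +-cong (⊛-cong (⊛-cong (≈-refl (E ⊛ O ⊛ V)) (trans (invPoch-step (d ℕ.+ M)) (⊛-cong (oneMinus-cong q^[d+M+1]) (≈-refl B))))
                    (invPoch-≡ (ℕP.m+n∸m≡n M (suc j))))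
            (⊛-cong (⊛-cong (⊛-cong (⊛-cong (qpow-split e M) (oneMinus-cong q^[M+1])) (≈-refl V)) (invPoch-≡ (ℕP.+-suc d M)))
                    (trans (invPoch-≡ d-[M+1]≡j) (invPoch-step j))) ⟩
    E ⊛ O ⊛ V ⊛ ((1PS ⊖ y ⊛ y ⊛ u ⊛ z) ⊛ B) ⊛ A ⊕ (E ⊛ y) ⊛ (1PS ⊖ y ⊛ z) ⊛ V ⊛ B ⊛ ((1PS ⊖ u) ⊛ A)
  ≈⟨ solve 7 (λ E y u z V B A →
        E :* (con (+ 1) :- y) :* V :* ((con (+ 1) :- y :* y :* u :* z) :* B) :* A
          :+ (E :* y) :* (con (+ 1) :- y :* z) :* V :* B :* ((con (+ 1) :- u) :* A)
        := (E :* (con (+ 1) :- y :* y :* z) :* A :* B) :* ((con (+ 1) :- y :* u) :* V)) (≈-refl _) E y u z V B A ⟩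
    (E ⊛ (1PS ⊖ y ⊛ y ⊛ z) ⊛ A ⊛ B) ⊛ ((1PS ⊖ y ⊛ u) ⊛ V)
  ≈⟨ *-congˡ {E ⊛ (1PS ⊖ y ⊛ y ⊛ z) ⊛ A ⊛ B}
       (trans (⊛-cong (sym (oneMinus-cong (qpow-split M (suc j)))) (≈-refl V)) (oneMinus-invOneMinus (m′ ℕ.+ suc j))) ⟩
    (E ⊛ (1PS ⊖ y ⊛ y ⊛ z) ⊛ A ⊛ B) ⊛ 1PS
  ≈⟨ *-identityʳ _ ⟩
    E ⊛ (1PS ⊖ y ⊛ y ⊛ z) ⊛ A ⊛ B
  ≈⟨ ⊛-cong (⊛-cong (⊛-cong (≈-refl E) (sym (oneMinus-cong q^[2M+1]))) (≈-refl A)) (≈-refl B) ⟩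
    pairedTerm e M (suc j) ∎
  where
  open Trunc n
  open TruncSolver n
  M = suc m′
  d = M ℕ.+ suc j
  E = qpow e
  O = 1PS ⊖ qpow M
  V = invOneMinus d
  y = qpow M
  u = qpow (suc j)
  z = qpow 1
  A = invPoch (suc j)
  B = invPoch (suc (d ℕ.+ M))
  d-[M+1]≡j : d ∸ suc M ≡ j
  d-[M+1]≡j = ≡.trans (cong (_∸ suc M) (ℕP.+-suc M j)) (ℕP.m+n∸m≡n M j)
  q^[M+1] : qpow (suc M) ≈[ n ] y ⊛ z
  q^[M+1] = trans (qpow-≡ (ℕP.+-comm 1 M)) (qpow-split M 1)
  q^[2M+1] : qpow (suc (M ℕ.+ M)) ≈[ n ] y ⊛ y ⊛ z
  q^[2M+1] = trans (qpow-≡ (ℕP.+-comm 1 (M ℕ.+ M))) (trans (qpow-split (M ℕ.+ M) 1) (⊛-cong (qpow-split M M) (≈-refl z)))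
  q^[d+M+1] : qpow (suc (d ℕ.+ M)) ≈[ n ] y ⊛ y ⊛ u ⊛ z
  q^[d+M+1] = trans (qpow-≡ (exponent-pair M j))
    (trans (qpow-split (M ℕ.+ M ℕ.+ suc j) 1) (⊛-cong (trans (qpow-split (M ℕ.+ M) (suc j)) (⊛-cong (qpow-split M M) (≈-refl u))) (≈-refl z)))

-- Summing the pairing identities over d: the d < M terms vanish and the
-- remaining ones are indexed by j = d - M.
sum-pairs : ∀ {n} m′ J (e : ℕ → ℕ) → let M = suc m′ ; D = m′ ℕ.+ J in
  sumPS D (λ i → rhsTerm (e (suc i)) M (suc i)) ⊕ sumPS D (λ i → rhsTerm (e (suc i) ℕ.+ M) (suc M) (suc i))
    ≈[ n ] sumPS J (λ j → pairedTerm (e (M ℕ.+ j)) M j)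
sum-pairs {n} m′ J e = begin
    sumPS (m′ ℕ.+ J) F₁ ⊕ sumPS (m′ ℕ.+ J) F₂
  ≈⟨ sym (sumPS-⊕ (m′ ℕ.+ J) F₁ F₂) ⟩
    sumPS (m′ ℕ.+ J) F
  ≈⟨ pointwise (sumPS-split m′ J F) ⟩
    sumPS m′ F ⊕ sumPS J (λ j → F (m′ ℕ.+ j))
  ≈⟨ +-cong (sumPS-vanish m′ F small) (sumPS-cong J (λ j _ → pair j)) ⟩
    constPS (+ 0) ⊕ sumPS J (λ j → pairedTerm (e (M ℕ.+ j)) M j)
  ≈⟨ +-identityˡ _ ⟩
    sumPS J (λ j → pairedTerm (e (M ℕ.+ j)) M j) ∎
  where
  open Trunc n
  M = suc m′
  F₁ F₂ F : ℕ → PS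
  F₁ i = rhsTerm (e (suc i)) M (suc i)
  F₂ i = rhsTerm (e (suc i) ℕ.+ M) (suc M) (suc i)
  F i = F₁ i ⊕ F₂ i
  small : ∀ i → i < m′ → F i ≈[ n ] constPS (+ 0)
  small i i<m′ = trans (+-cong (rhsTerm-vanish (e (suc i)) M (suc i) (s≤s i<m′))
                               (rhsTerm-vanish (e (suc i) ℕ.+ M) (suc M) (suc i) (ℕP.≤-trans (s≤s i<m′) (ℕP.n≤1+n M))))
                       (+-identityˡ (constPS (+ 0)))
  pair : ∀ j → F (m′ ℕ.+ j) ≈[ n ] pairedTerm (e (M ℕ.+ j)) M j
  pair zero    = trans (≡⇒≈ (cong (λ d → rhsTerm (e d) M d ⊕ rhsTerm (e d ℕ.+ M) (suc M) d) (ℕP.+-identityʳ M)))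
                       (trans (rhsTerm-pair₀ (e M) m′) (≡⇒≈ (cong (λ d → pairedTerm (e d) M 0) (≡.sym (ℕP.+-identityʳ M)))))
  pair (suc j) = rhsTerm-pair (e (M ℕ.+ suc j)) m′ j

exponent-paired : ∀ M j → j ℕ.+ suc (M ℕ.+ M) ≡ suc (M ℕ.+ j ℕ.+ M)
exponent-paired = solve 2 (λ M j → j :+ (con 1 :+ (M :+ M)) := con 1 :+ (M :+ j :+ M)) refl
  where open ℕSolver.+-*-Solver

pairedTerm-durfee : ∀ {n} e base k M j → e ≡ base ℕ.+ (j ℕ.* j ℕ.+ k ℕ.* j) →
  pairedTerm e M j ≈[ n ] (qpow base ⊛ (1PS ⊖ qpow (suc (M ℕ.+ M)))) ⊛ durfeeTerm k (suc (M ℕ.+ M)) j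
pairedTerm-durfee {n} e base k M j e≡ = begin
    qpow e ⊛ O₂ ⊛ invPoch j ⊛ invPoch (suc (M ℕ.+ j ℕ.+ M))
  ≈⟨ ⊛-cong (⊛-cong (⊛-cong (trans (qpow-≡ e≡) (qpow-split base _)) (≈-refl O₂)) (≈-refl (invPoch j)))
            (invPoch-≡ (≡.sym (exponent-paired M j))) ⟩
    qpow base ⊛ X ⊛ O₂ ⊛ invPoch j ⊛ invPoch (j ℕ.+ suc (M ℕ.+ M))
  ≈⟨ solve 5 (λ B X O A Z → B :* X :* O :* A :* Z := (B :* O) :* (X :* A :* Z))
             (≈-refl _) (qpow base) X O₂ (invPoch j) (invPoch (j ℕ.+ suc (M ℕ.+ M))) ⟩
    (qpow base ⊛ O₂) ⊛ durfeeTerm k (suc (M ℕ.+ M)) j ∎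
  where
  open Trunc n
  open TruncSolver n
  O₂ = 1PS ⊖ qpow (suc (M ℕ.+ M))
  X = qpow (j ℕ.* j ℕ.+ k ℕ.* j)

sum-consecutive : ∀ {n} (ex : ℕ → ℕ → ℕ) base k m′ K → let M = suc m′ in m′ ≤ K →
  (∀ d → ex (suc M) d ≡ ex M d ℕ.+ M) →
  (∀ j → ex M (M ℕ.+ j) ≡ base ℕ.+ (j ℕ.* j ℕ.+ k ℕ.* j)) →
  partialSum (λ d → rhsTerm (ex M d) M d) K ⊕ partialSum (λ d → rhsTerm (ex (suc M) d) (suc M) d) K
    ≈[ n ] (qpow base ⊛ (1PS ⊖ qpow (suc (M ℕ.+ M)))) ⊛ durfeeSum k (suc (M ℕ.+ M)) (K ∸ m′)
sum-consecutive {n} ex base k m′ K m′≤K ex-step ex-diag = begin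
    sumPS K F₁ ⊕ sumPS K F₂
  ≈⟨ +-cong (≡⇒≈ (cong (λ x → sumPS x F₁) K≡m′+J))
            (trans (≡⇒≈ (cong (λ x → sumPS x F₂) K≡m′+J))
                   (sumPS-cong (m′ ℕ.+ J) (λ i _ → ≡⇒≈ (cong (λ e → rhsTerm e (suc M) (suc i)) (ex-step (suc i)))))) ⟩
    sumPS (m′ ℕ.+ J) F₁ ⊕ sumPS (m′ ℕ.+ J) (λ i → rhsTerm (ex M (suc i) ℕ.+ M) (suc M) (suc i))
  ≈⟨ sum-pairs m′ J (ex M) ⟩
    sumPS J (λ j → pairedTerm (ex M (M ℕ.+ j)) M j)
  ≈⟨ sumPS-cong J (λ j _ → pairedTerm-durfee (ex M (M ℕ.+ j)) base k M j (ex-diag j)) ⟩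
    sumPS J (λ j → a ⊛ durfeeTerm k (suc (M ℕ.+ M)) j)
  ≈⟨ sumPS-⊛ J a (durfeeTerm k (suc (M ℕ.+ M))) ⟩
    a ⊛ durfeeSum k (suc (M ℕ.+ M)) J ∎
  where
  open Trunc n
  M = suc m′
  J = K ∸ m′
  a = qpow base ⊛ (1PS ⊖ qpow (suc (M ℕ.+ M)))
  F₁ = λ i → rhsTerm (ex M (suc i)) M (suc i)
  F₂ = λ i → rhsTerm (ex (suc M) (suc i)) (suc M) (suc i)
  K≡m′+J : K ≡ m′ ℕ.+ J
  K≡m′+J = ≡.sym (ℕP.m+[n∸m]≡n m′≤K)

-- Base case m = 1.  If  ex 1 d = d² + k d,  each summand is (1 - q) times the
-- Durfee term T(k, 1, d), and the leading 1 = (1 - q) T(k, 1, 0).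
sum-first : ∀ {n} k (ex : ℕ → ℕ → ℕ) → (∀ i → ex 1 (suc i) ≡ suc i ℕ.* suc i ℕ.+ k ℕ.* suc i) → ∀ K →
  1PS ⊕ sgn 0 · partialSum (λ d → rhsTerm (ex 1 d) 1 d) K ≈[ n ] (1PS ⊖ qpow 1) ⊛ durfeeSum k 1 (suc K)
sum-first {n} k ex ex-1 K = begin
    1PS ⊕ sgn 0 · sumPS K (λ i → rhsTerm (ex 1 (suc i)) 1 (suc i))
  ≈⟨ +-congˡ {1PS} (trans (·-as-⊛ (+ 1) _) (trans (*-identityˡ _)
       (trans (sumPS-cong K (λ i _ → summand i)) (sumPS-⊛ K O (durfeeTerm k 1 ∘ suc))))) ⟩
    1PS ⊕ O ⊛ Tail
  ≈⟨ +-congʳ (sym (trans (⊛-cong (sym (*-identityˡ O)) (≈-refl (invPoch 1))) (qqPoch-invPoch 1))) ⟩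
    O ⊛ invPoch 1 ⊕ O ⊛ Tail
  ≈⟨ solve 3 (λ O I S → O :* I :+ O :* S := O :* (con (+ 1) :* con (+ 1) :* I :+ S)) (≈-refl _) O (invPoch 1) Tail ⟩
    O ⊛ (1PS ⊛ 1PS ⊛ invPoch 1 ⊕ Tail)
  ≈⟨ *-congˡ {O} (+-congʳ (⊛-cong (⊛-cong (trans (qpow-≡ (ℕP.*-zeroʳ k)) (pointwise qpow-zero)) invPoch-zero)
                                  (≈-refl (invPoch 1)))) ⟨
    O ⊛ (durfeeTerm k 1 0 ⊕ Tail)
  ≈⟨ *-congˡ {O} (sumPS-first K (durfeeTerm k 1)) ⟨
    O ⊛ durfeeSum k 1 (suc K) ∎
  where
  open Trunc n
  open TruncSolver n
  O = 1PS ⊖ qpow 1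
  Tail = sumPS K (durfeeTerm k 1 ∘ suc)
  summand : ∀ i → rhsTerm (ex 1 (suc i)) 1 (suc i) ≈[ n ] O ⊛ durfeeTerm k 1 (suc i)
  summand i = begin
      rhsTerm (ex 1 (suc i)) 1 (suc i)
    ≈⟨ rhsTerm-simplify (ex 1 (suc i)) 1 (suc i) (s≤s z≤n) ⟩
      qpow (ex 1 (suc i)) ⊛ O ⊛ invOneMinus (suc i) ⊛ invPoch (suc i ℕ.+ 1) ⊛ invPoch i
    ≈⟨ ⊛-cong (⊛-cong (⊛-cong (⊛-cong (qpow-≡ (ex-1 i)) (≈-refl O)) (≈-refl (invOneMinus (suc i))))
                      (≈-refl (invPoch (suc i ℕ.+ 1))))
              (invPoch-step i) ⟩
      E ⊛ O ⊛ invOneMinus (suc i) ⊛ invPoch (suc i ℕ.+ 1) ⊛ ((1PS ⊖ qpow (suc i)) ⊛ invPoch (suc i))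
    ≈⟨ solve 6 (λ E O V B Q A → E :* O :* V :* B :* ((con (+ 1) :- Q) :* A) := ((con (+ 1) :- Q) :* V) :* (O :* (E :* A :* B)))
               (≈-refl _) E O (invOneMinus (suc i)) (invPoch (suc i ℕ.+ 1)) (qpow (suc i)) (invPoch (suc i)) ⟩
      ((1PS ⊖ qpow (suc i)) ⊛ invOneMinus (suc i)) ⊛ (O ⊛ durfeeTerm k 1 (suc i))
    ≈⟨ ⊛-cong (oneMinus-invOneMinus i) (≈-refl (O ⊛ durfeeTerm k 1 (suc i))) ⟩
      1PS ⊛ (O ⊛ durfeeTerm k 1 (suc i))
    ≈⟨ *-identityˡ _ ⟩
      O ⊛ durfeeTerm k 1 (suc i) ∎
    where E = qpow (suc i ℕ.* suc i ℕ.+ k ℕ.* suc i)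

-- Then every case holds:
--   1 + (-1)^M S_(M+1) = (1 + (-1)^(M-1) S_M) + (-1)^M (S_M + S_(M+1)).
module Telescoping
  (T : ℕ → ℕ → PS) (L P : ℕ → PS)
  (L-step : ∀ M → L (suc M) ≡ L M ⊕ sgn M · P M)
  (case-one : ∀ n K → suc n ℕ.+ 1 ≤ K → invPoch n ⊛ L 1 ≈[ n ] 1PS ⊕ sgn 0 · partialSum (T 1) K)
  (consecutive : ∀ n m′ K → suc n ℕ.+ suc (suc m′) ≤ K →
     partialSum (T (suc m′)) K ⊕ partialSum (T (suc (suc m′))) K ≈[ n ] invPoch n ⊛ P (suc m′))
  where

  every-case : ∀ n m′ K → suc n ℕ.+ suc m′ ≤ K →
    invPoch n ⊛ L (suc m′) ≈[ n ] 1PS ⊕ sgn m′ · partialSum (T (suc m′)) K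
  every-case n zero      K n+1<K = case-one n K n+1<K
  every-case n (suc m′) K bound = begin
      invPoch n ⊛ L (suc M)
    ≈⟨ *-congˡ {invPoch n} (trans (≡⇒≈ (L-step M))
         (+-congˡ {L M} (trans (·-as-⊛ (sgn M) (P M)) (⊛-cong sign-step (≈-refl (P M)))))) ⟩
      invPoch n ⊛ (L M ⊕ (−1 ⊛ s) ⊛ P M)
    ≈⟨ solve 4 (λ I L s P → I :* (L :+ (con (ℤ.- + 1) :* s) :* P) := I :* L :+ (con (ℤ.- + 1) :* s) :* (I :* P))
               (≈-refl _) (invPoch n) (L M) s (P M) ⟩
      invPoch n ⊛ L M ⊕ (−1 ⊛ s) ⊛ (invPoch n ⊛ P M)
    ≈⟨ +-cong (trans (every-case n m′ K (ℕP.≤-trans (ℕP.+-monoʳ-≤ (suc n) (ℕP.n≤1+n M)) bound))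
                     (+-congˡ {1PS} (·-as-⊛ (sgn m′) S)))
              (*-congˡ {−1 ⊛ s} (sym (consecutive n m′ K bound))) ⟩
      1PS ⊕ s ⊛ S ⊕ (−1 ⊛ s) ⊛ (S ⊕ S′)
    ≈⟨ solve 3 (λ s S S′ → con (+ 1) :+ s :* S :+ (con (ℤ.- + 1) :* s) :* (S :+ S′)
                           := con (+ 1) :+ (con (ℤ.- + 1) :* s) :* S′)
               (≈-refl _) s S S′ ⟩
      1PS ⊕ (−1 ⊛ s) ⊛ S′
    ≈⟨ +-congˡ {1PS} (trans (·-as-⊛ (sgn M) S′) (⊛-cong sign-step (≈-refl S′))) ⟨
      1PS ⊕ sgn M · S′ ∎
    where
    open Trunc n
    open TruncSolver n
    M = suc m′
    −1 = constPS (ℤ.- + 1)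
    s = constPS (sgn m′)
    S = partialSum (T M) K
    S′ = partialSum (T (suc M)) K
    sign-step : constPS (sgn M) ≈[ n ] −1 ⊛ s
    sign-step = pointwise (const-* (ℤ.- + 1) (sgn m′))

-- Exponent arithmetic.  Halving is exact on the even numbers used here.
half-+ : ∀ x y → (x ℕ.+ y ℕ.* 2) ℕ./ 2 ≡ x ℕ./ 2 ℕ.+ y
half-+ x y = ≡.trans (+-distrib-/-∣ʳ x (divides y refl)) (cong (x ℕ./ 2 ℕ.+_) (m*n/n≡m y 2))

choose2-suc : ∀ m′ → choose2 (suc (suc m′)) ≡ choose2 (suc m′) ℕ.+ suc m′
choose2-suc m′ = ≡.trans (cong (ℕ._/ 2) (expand m′)) (half-+ (suc m′ ℕ.* m′) (suc m′))
  where
  open ℕSolver.+-*-Solver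
  expand : ∀ m → suc (suc m) ℕ.* suc m ≡ suc m ℕ.* m ℕ.+ suc m ℕ.* 2
  expand = solve 1 (λ m → (con 2 :+ m) :* (con 1 :+ m) := (con 1 :+ m) :* m :+ (con 1 :+ m) :* con 2) refl

pentagonal₁ pentagonal₂ : ℕ → ℕ
pentagonal₁ l = (l ℕ.* (3 ℕ.* l ℕ.+ 1)) ℕ./ 2
pentagonal₂ l = (l ℕ.* (3 ℕ.* l ∸ 1)) ℕ./ 2

pentagonal₁-suc : ∀ m′ → let M = suc m′ in pentagonal₁ M ≡ choose2 M ℕ.+ (M ℕ.* M ℕ.+ M)
pentagonal₁-suc m′ = ≡.trans (cong (ℕ._/ 2) (expand m′)) (half-+ (suc m′ ℕ.* m′) _)
  where
  open ℕSolver.+-*-Solver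
  expand : ∀ m → suc m ℕ.* (3 ℕ.* suc m ℕ.+ 1) ≡ suc m ℕ.* m ℕ.+ (suc m ℕ.* suc m ℕ.+ suc m) ℕ.* 2
  expand = solve 1 (λ m → (con 1 :+ m) :* (con 3 :* (con 1 :+ m) :+ con 1)
                          := (con 1 :+ m) :* m :+ ((con 1 :+ m) :* (con 1 :+ m) :+ (con 1 :+ m)) :* con 2) refl

pentagonal₂-suc : ∀ m′ → let M = suc m′ in pentagonal₂ M ≡ choose2 M ℕ.+ M ℕ.* M
pentagonal₂-suc m′ = ≡.trans (cong (λ x → (suc m′ ℕ.* x) ℕ./ 2) (3M-1 m′))
                              (≡.trans (cong (ℕ._/ 2) (expand m′)) (half-+ (suc m′ ℕ.* m′) _))
  where
  open ℕSolver.+-*-Solver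
  3M-1 : ∀ m → m ℕ.+ (suc m ℕ.+ (suc m ℕ.+ 0)) ≡ 2 ℕ.+ 3 ℕ.* m
  3M-1 = solve 1 (λ m → m :+ ((con 1 :+ m) :+ ((con 1 :+ m) :+ con 0)) := con 2 :+ con 3 :* m) refl
  expand : ∀ m → suc m ℕ.* (2 ℕ.+ 3 ℕ.* m) ≡ suc m ℕ.* m ℕ.+ (suc m ℕ.* suc m) ℕ.* 2
  expand = solve 1 (λ m → (con 1 :+ m) :* (con 2 :+ con 3 :* m)
                          := (con 1 :+ m) :* m :+ ((con 1 :+ m) :* (con 1 :+ m)) :* con 2) refl

exponent₁ exponent₂ : ℕ → ℕ → ℕ
exponent₁ m d = d ℕ.* d ℕ.+ d ℕ.+ choose2 m
exponent₂ m d = d ℕ.* d ℕ.+ choose2 m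

exponent₁-suc : ∀ m′ d → exponent₁ (suc (suc m′)) d ≡ exponent₁ (suc m′) d ℕ.+ suc m′
exponent₁-suc m′ d = ≡.trans (cong (d ℕ.* d ℕ.+ d ℕ.+_) (choose2-suc m′))
                             (≡.sym (ℕP.+-assoc (d ℕ.* d ℕ.+ d) (choose2 (suc m′)) (suc m′)))

exponent₂-suc : ∀ m′ d → exponent₂ (suc (suc m′)) d ≡ exponent₂ (suc m′) d ℕ.+ suc m′
exponent₂-suc m′ d = ≡.trans (cong (d ℕ.* d ℕ.+_) (choose2-suc m′))
                             (≡.sym (ℕP.+-assoc (d ℕ.* d) (choose2 (suc m′)) (suc m′)))

exponent₁-diag : ∀ m′ j → let M = suc m′ in
  exponent₁ M (M ℕ.+ j) ≡ pentagonal₁ M ℕ.+ (j ℕ.* j ℕ.+ suc (M ℕ.+ M) ℕ.* j)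
exponent₁-diag m′ j = ≡.trans (expand (suc m′) j (choose2 (suc m′)))
                              (cong (ℕ._+ (j ℕ.* j ℕ.+ suc (suc m′ ℕ.+ suc m′) ℕ.* j)) (≡.sym (pentagonal₁-suc m′)))
  where
  open ℕSolver.+-*-Solver
  expand : ∀ M j c → (M ℕ.+ j) ℕ.* (M ℕ.+ j) ℕ.+ (M ℕ.+ j) ℕ.+ c
                     ≡ (c ℕ.+ (M ℕ.* M ℕ.+ M)) ℕ.+ (j ℕ.* j ℕ.+ suc (M ℕ.+ M) ℕ.* j)
  expand = solve 3 (λ M j c → (M :+ j) :* (M :+ j) :+ (M :+ j) :+ c
                              := (c :+ (M :* M :+ M)) :+ (j :* j :+ (con 1 :+ (M :+ M)) :* j)) refl

exponent₂-diag : ∀ m′ j → let M = suc m′ in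
  exponent₂ M (M ℕ.+ j) ≡ pentagonal₂ M ℕ.+ (j ℕ.* j ℕ.+ (M ℕ.+ M) ℕ.* j)
exponent₂-diag m′ j = ≡.trans (expand (suc m′) j (choose2 (suc m′)))
                              (cong (ℕ._+ (j ℕ.* j ℕ.+ (suc m′ ℕ.+ suc m′) ℕ.* j)) (≡.sym (pentagonal₂-suc m′)))
  where
  open ℕSolver.+-*-Solver
  expand : ∀ M j c → (M ℕ.+ j) ℕ.* (M ℕ.+ j) ℕ.+ c ≡ (c ℕ.+ M ℕ.* M) ℕ.+ (j ℕ.* j ℕ.+ (M ℕ.+ M) ℕ.* j)
  expand = solve 3 (λ M j c → (M :+ j) :* (M :+ j) :+ c := (c :+ M :* M) :+ (j :* j :+ (M :+ M) :* j)) refl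

exponent₁-one : ∀ i → exponent₁ 1 (suc i) ≡ suc i ℕ.* suc i ℕ.+ 1 ℕ.* suc i
exponent₁-one = solve 1 (λ i → (con 1 :+ i) :* (con 1 :+ i) :+ (con 1 :+ i) :+ con 0
                               := (con 1 :+ i) :* (con 1 :+ i) :+ con 1 :* (con 1 :+ i)) refl
  where open ℕSolver.+-*-Solver

exponent₂-one : ∀ i → exponent₂ 1 (suc i) ≡ suc i ℕ.* suc i ℕ.+ 0 ℕ.* suc i
exponent₂-one = solve 1 (λ i → (con 1 :+ i) :* (con 1 :+ i) :+ con 0
                               := (con 1 :+ i) :* (con 1 :+ i) :+ con 0 :* (con 1 :+ i)) refl
  where open ℕSolver.+-*-Solver

leftTerm₁ leftTerm₂ : ℕ → PS
leftTerm₁ l = qpow (pentagonal₁ l) ⊛ (1PS ⊖ qpow (2 ℕ.* l ℕ.+ 1))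
leftTerm₂ l = qpow (pentagonal₂ l) ⊛ (1PS ⊖ qpow (4 ℕ.* l ℕ.+ 2))

odd-exponent : ∀ M → 2 ℕ.* M ℕ.+ 1 ≡ suc (M ℕ.+ M)
odd-exponent = solve 1 (λ M → con 2 :* M :+ con 1 := con 1 :+ (M :+ M)) refl
  where open ℕSolver.+-*-Solver

double-odd-exponent : ∀ M → 4 ℕ.* M ℕ.+ 2 ≡ suc (M ℕ.+ M) ℕ.+ suc (M ℕ.+ M)
double-odd-exponent = solve 1 (λ M → con 4 :* M :+ con 2 := (con 1 :+ (M :+ M)) :+ (con 1 :+ (M :+ M))) refl
  where open ℕSolver.+-*-Solver

enough-terms : ∀ n m′ K → suc n ℕ.+ suc (suc m′) ≤ K → m′ ≤ K × suc n ≤ K ∸ m′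
enough-terms n m′ K bound =
    ℕP.≤-trans (ℕP.≤-trans m′≤m′+2 (ℕP.m≤n+m (suc (suc m′)) (suc n))) bound
  , ℕP.≤-trans (ℕP.≤-reflexive (≡.sym (ℕP.m+n∸n≡m (suc n) m′)))
               (ℕP.∸-monoˡ-≤ m′ (ℕP.≤-trans (ℕP.+-monoʳ-≤ (suc n) m′≤m′+2) bound))
  where
  m′≤m′+2 : m′ ≤ suc (suc m′)
  m′≤m′+2 = ℕP.≤-trans (ℕP.n≤1+n m′) (ℕP.n≤1+n (suc m′))

-- Consecutive right-hand sums of the first identity add up to the l = M term
-- of its left-hand side, over (q;q)_∞ (Durfee identity with k = 2M+1).
consecutive₁ : ∀ n m′ K → suc n ℕ.+ suc (suc m′) ≤ K →
  partialSum (term₁ (suc m′)) K ⊕ partialSum (term₁ (suc (suc m′))) K ≈[ n ] invPoch n ⊛ leftTerm₁ (suc m′)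
consecutive₁ n m′ K bound = begin
    partialSum (term₁ M) K ⊕ partialSum (term₁ (suc M)) K
  ≈⟨ sum-consecutive exponent₁ (pentagonal₁ M) k m′ K (proj₁ enough) (exponent₁-suc m′) (exponent₁-diag m′) ⟩
    a ⊛ durfeeSum k k (K ∸ m′)
  ≈⟨ *-congˡ {a} (trans (durfeeSum-stable n k k (K ∸ m′) (proj₂ enough)) (durfee-identity k)) ⟩
    a ⊛ invPoch n
  ≈⟨ *-comm a (invPoch n) ⟩
    invPoch n ⊛ a
  ≈⟨ *-congˡ {invPoch n} (*-congˡ {qpow (pentagonal₁ M)} (oneMinus-cong (qpow-≡ (≡.sym (odd-exponent M))))) ⟩
    invPoch n ⊛ leftTerm₁ M ∎
  where
  open Trunc n
  M = suc m′
  k = suc (M ℕ.+ M)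
  a = qpow (pentagonal₁ M) ⊛ (1PS ⊖ qpow k)
  enough = enough-terms n m′ K bound

-- The same for the second identity (Durfee identity with k = 2M, b = 2M+1).
consecutive₂ : ∀ n m′ K → suc n ℕ.+ suc (suc m′) ≤ K →
  partialSum (term₂ (suc m′)) K ⊕ partialSum (term₂ (suc (suc m′))) K ≈[ n ] invPoch n ⊛ leftTerm₂ (suc m′)
consecutive₂ n m′ K bound = begin
    partialSum (term₂ M) K ⊕ partialSum (term₂ (suc M)) K
  ≈⟨ sum-consecutive exponent₂ (pentagonal₂ M) (M ℕ.+ M) m′ K (proj₁ enough) (exponent₂-suc m′) (exponent₂-diag m′) ⟩
    a ⊛ durfeeSum (M ℕ.+ M) k (K ∸ m′)
  ≈⟨ *-congˡ {a} (trans (durfeeSum-stable n (M ℕ.+ M) k (K ∸ m′) (proj₂ enough)) (durfee-identity′ (M ℕ.+ M))) ⟩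
    qpow (pentagonal₂ M) ⊛ (1PS ⊖ y) ⊛ ((1PS ⊕ y) ⊛ invPoch n)
  ≈⟨ solve 3 (λ B y I → B :* (con (+ 1) :- y) :* ((con (+ 1) :+ y) :* I) := I :* (B :* (con (+ 1) :- y :* y)))
             (≈-refl _) (qpow (pentagonal₂ M)) y (invPoch n) ⟩
    invPoch n ⊛ (qpow (pentagonal₂ M) ⊛ (1PS ⊖ y ⊛ y))
  ≈⟨ *-congˡ {invPoch n} (*-congˡ {qpow (pentagonal₂ M)}
       (sym (oneMinus-cong (trans (qpow-≡ (double-odd-exponent M)) (qpow-split k k))))) ⟩
    invPoch n ⊛ leftTerm₂ M ∎
  where
  open Trunc n
  open TruncSolver n
  M = suc m′
  k = suc (M ℕ.+ M)
  y = qpow k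
  a = qpow (pentagonal₂ M) ⊛ (1PS ⊖ y)
  enough = enough-terms n m′ K bound

-- The case m = 1 of both identities: 1/(q;q)_∞ times (1 - q), resp. (1 - q²),
-- via the Durfee identities with k = 1, resp. k = 0.
case-one₁ : ∀ n K → suc n ℕ.+ 1 ≤ K → invPoch n ⊛ lhsPoly₁ 1 ≈[ n ] 1PS ⊕ sgn 0 · partialSum (term₁ 1) K
case-one₁ n K bound = begin
    invPoch n ⊛ lhsPoly₁ 1
  ≈⟨ *-congˡ {invPoch n} (+-cong zero-series (trans (·-as-⊛ (+ 1) (qpow 0 ⊛ O))
                                                    (*-congˡ {1PS} (⊛-cong (pointwise qpow-zero) (≈-refl O))))) ⟩
    invPoch n ⊛ (constPS (+ 0) ⊕ 1PS ⊛ (1PS ⊛ O))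
  ≈⟨ solve 2 (λ I O → I :* (con (+ 0) :+ con (+ 1) :* (con (+ 1) :* O)) := O :* I) (≈-refl _) (invPoch n) O ⟩
    O ⊛ invPoch n
  ≈⟨ *-congˡ {O} (trans (durfeeSum-stable n 1 1 (suc K) (ℕP.m≤n⇒m≤1+n (ℕP.≤-trans (ℕP.m≤m+n (suc n) 1) bound)))
                        (durfee-identity 1)) ⟨
    O ⊛ durfeeSum 1 1 (suc K)
  ≈⟨ sum-first 1 exponent₁ exponent₁-one K ⟨
    1PS ⊕ sgn 0 · partialSum (term₁ 1) K ∎
  where
  open Trunc n
  open TruncSolver n
  O = 1PS ⊖ qpow 1

case-one₂ : ∀ n K → suc n ℕ.+ 1 ≤ K → invPoch n ⊛ lhsPoly₂ 1 ≈[ n ] 1PS ⊕ sgn 0 · partialSum (term₂ 1) K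
case-one₂ n K bound = begin
    invPoch n ⊛ lhsPoly₂ 1
  ≈⟨ *-congˡ {invPoch n} (+-cong zero-series (trans (·-as-⊛ (+ 1) (qpow 0 ⊛ (1PS ⊖ qpow 2)))
                            (*-congˡ {1PS} (⊛-cong (pointwise qpow-zero) (oneMinus-cong (qpow-split 1 1)))))) ⟩
    invPoch n ⊛ (constPS (+ 0) ⊕ 1PS ⊛ (1PS ⊛ (1PS ⊖ q ⊛ q)))
  ≈⟨ solve 2 (λ I q → I :* (con (+ 0) :+ con (+ 1) :* (con (+ 1) :* (con (+ 1) :- q :* q)))
                      := (con (+ 1) :- q) :* ((con (+ 1) :+ q) :* I)) (≈-refl _) (invPoch n) q ⟩
    O ⊛ ((1PS ⊕ q) ⊛ invPoch n)
  ≈⟨ *-congˡ {O} (trans (durfeeSum-stable n 0 1 (suc K) (ℕP.m≤n⇒m≤1+n (ℕP.≤-trans (ℕP.m≤m+n (suc n) 1) bound)))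
                        (durfee-identity′ 0)) ⟨
    O ⊛ durfeeSum 0 1 (suc K)
  ≈⟨ sum-first 0 exponent₂ exponent₂-one K ⟨
    1PS ⊕ sgn 0 · partialSum (term₂ 1) K ∎
  where
  open Trunc n
  open TruncSolver n
  q = qpow 1
  O = 1PS ⊖ q

-- Turning truncated identities into coefficientwise limits: 1/(q;q)_N agrees
-- with 1/(q;q)_n below degree n+1 for N ≥ n.
converges : ∀ c (L : PS) (R : ℕ → PS) →
  (∀ n N → suc n ℕ.+ c ≤ N → invPoch n ⊛ L ≈[ n ] R N) → SameLimit (λ N → inv (qqPoch N) ⊛ L) R
converges c L R approx n = suc n ℕ.+ c , λ N bound →
  coeff (Trunc.trans n (⊛-cong (invPoch-stable n N (n≤N N bound)) (≈-refl L)) (approx n N bound)) n ℕP.≤-refl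
  where
  n≤N : ∀ N → suc n ℕ.+ c ≤ N → n ≤ N
  n≤N N bound = ℕP.≤-trans (ℕP.≤-trans (ℕP.n≤1+n n) (ℕP.m≤m+n (suc n) c)) bound

module First  = Telescoping term₁ lhsPoly₁ leftTerm₁ (λ _ → refl) case-one₁ consecutive₁
module Second = Telescoping term₂ lhsPoly₂ leftTerm₂ (λ _ → refl) case-one₂ consecutive₂

corollary1p3 : (m : ℕ) → 1 ≤ m →
    SameLimit (λ N → inv (qqPoch N) ⊛ lhsPoly₁ m)
              (λ N → 1PS ⊕ sgn (m ∸ 1) · partialSum (term₁ m) N)
    × SameLimit (λ N → inv (qqPoch N) ⊛ lhsPoly₂ m)
                (λ N → 1PS ⊕ sgn (m ∸ 1) · partialSum (term₂ m) N)
corollary1p3 (suc m′) _ =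
    converges (suc m′) (lhsPoly₁ (suc m′)) _ (λ n N → First.every-case n m′ N)
  , converges (suc m′) (lhsPoly₂ (suc m′)) _ (λ n N → Second.every-case n m′ N)
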